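{- A sequence $f\colon\mathbb{N}^d\to\mathbb{N}^{d'}$ is $\boldsymbol{\mathcal{S}}$-automatic if and only if it is $(\boldsymbol{\mathcal{S}},\boldsymbol{\mathcal{S}}')$-synchronized and takes only finitely many values.
   Context: An abstract numeration system is a triple $\mathcal{S}=(L,A,<)$ where $L$ is an infinite regular language over a finite alphabet $A$ totally ordered by $<$. Words are ordered by the radix order ($u<_{\rm rad}v$ iff $|u|<|v|$, or $|u|=|v|$ and $u$ is lexicographically smaller); $\mathrm{rep}_{\mathcal{S}}\colon\mathbb{N}\to L$ maps $n$ to the $n$-th word of $L$ (indexing from $0$). For $e\ge1$, abstract numeration systems $\mathcal{T}_j=(K_j,B_j,<_j)$ and a symbol $\#\notin\bigcup_jB_j$, the $e$-dimensional system $\boldsymbol{\mathcal{T}}=(\mathcal{T}_1,\dots,\mathcal{T}_e)$ has alphabet $\boldsymbol{B}=\big((B_1\cup\{\#\})\times\cdots\times(B_e\cup\{\#\})\big)\setminus\{(\#,\dots,\#)\}$ and $\mathrm{rep}_{\boldsymbol{\mathcal{T}}}(n_1,\dots,n_e)$ is the word over $\boldsymbol{B}$ obtained by left-padding each $\mathrm{rep}_{\mathcal{T}_j}(n_j)$ with $\#$'s to the maximal length and reading them in parallel. A set $X\subseteq\mathbb{N}^e$ is $\boldsymbol{\mathcal{T}}$-recognizable if $\mathrm{rep}_{\boldsymbol{\mathcal{T}}}(X)$ is regular. $\boldsymbol{\mathcal{S}}=(\mathcal{S}_1,\dots,\mathcal{S}_d)$ (alphabet $\boldsymbol{A}$) and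 $\boldsymbol{\mathcal{S}}'=(\mathcal{S}'_1,\dots,\mathcal{S}'_{d'})$ are fixed, and $(\boldsymbol{\mathcal{S}},\boldsymbol{\mathcal{S}}')=(\mathcal{S}_1,\dots,\mathcal{S}_d,\mathcal{S}'_1,\dots,\mathcal{S}'_{d'})$. A sequence $f\colon\mathbb{N}^d\to\mathbb{N}^{d'}$ is $\boldsymbol{\mathcal{S}}$-automatic if there is a deterministic finite automaton with output $(Q,q_0,\delta,\boldsymbol{A},\tau,\Delta)$ with finite output alphabet $\Delta\subseteq\mathbb{N}^{d'}$ such that $f(\boldsymbol{n})=\tau(\delta(q_0,\mathrm{rep}_{\boldsymbol{\mathcal{S}}}(\boldsymbol{n})))$ for all $\boldsymbol{n}$. It is $(\boldsymbol{\mathcal{S}},\boldsymbol{\mathcal{S}}')$-synchronized if its graph $\{(\boldsymbol{n},f(\boldsymbol{n})):\boldsymbol{n}\in\mathbb{N}^d\}$ is an $(\boldsymbol{\mathcal{S}},\boldsymbol{\mathcal{S}}')$-recognizable subset of $\mathbb{N}^{d+d'}$. -}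

module Defs where

open import Data.Nat using (ℕ; zero; suc; _+_; _∸_; _⊔_; _≤_; _<ᵇ_; _≡ᵇ_)
open import Data.Fin using (Fin; toℕ)
open import Data.Bool using (Bool; true; false; _∧_; _∨_; if_then_else_; T)
open import Data.List using (List; []; _∷_; length; map; replicate; _++_; concatMap; upTo; allFin)
open import Data.List.Membership.Propositional using (_∈_)
open import Data.Maybe using (Maybe; just; nothing)
open import Data.Vec using (Vec) renaming ([] to []ᵥ; _∷_ to _∷ᵥ_; _++_ to _++ᵥ_)
open import Data.Vec.Relation.Unary.All using (All) renaming ([] to []ₐ; _∷_ to _∷ₐ_)
open import Data.Product using (Σ; _×_; _,_; proj₁)
open import Data.Unit using (⊤)
open import Relation.Nullary using (¬_)
open import Relation.Binary.PropositionalEquality using (_≡_)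
open import Function.Bundles using (_⇔_)

record DFA (A : Set) : Set where
  field
    nQ : ℕ
    q₀ : Fin nQ
    δ  : Fin nQ → A → Fin nQ

runFrom : {A : Set} (M : DFA A) → Fin (DFA.nQ M) → List A → Fin (DFA.nQ M)
runFrom M q []      = q
runFrom M q (a ∷ w) = runFrom M (DFA.δ M q a) w

run : {A : Set} (M : DFA A) → List A → Fin (DFA.nQ M)
run M w = runFrom M (DFA.q₀ M) w

accepts : {A : Set} (M : DFA A) → (Fin (DFA.nQ M) → Bool) → List A → Bool
accepts M F w = F (run M w)

-- The finite totally ordered alphabet is
-- Fin k with its natural order; the regular language L is given by a DFA
-- with final-state predicate; L is required to be infinite.

record ANS : Set where
  field
    k        : ℕ
    aut      : DFA (Fin k)
    final    : Fin (DFA.nQ aut) → Bool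
    infinite : ∀ m → Σ (List (Fin k)) λ w → m ≤ length w × T (accepts aut final w)

inL : (S : ANS) → List (Fin (ANS.k S)) → Bool
inL S w = accepts (ANS.aut S) (ANS.final S) w

allWords : (k : ℕ) → ℕ → List (List (Fin k))
allWords k zero    = [] ∷ []
allWords k (suc ℓ) = concatMap (λ a → map (a ∷_) (allWords k ℓ)) (allFin k)

lexLt : {k : ℕ} → List (Fin k) → List (Fin k) → Bool
lexLt []      []      = false
lexLt []      (_ ∷ _) = true
lexLt (_ ∷ _) []      = false
lexLt (a ∷ u) (b ∷ v) = (toℕ a <ᵇ toℕ b) ∨ ((toℕ a ≡ᵇ toℕ b) ∧ lexLt u v)

radLt : {k : ℕ} → List (Fin k) → List (Fin k) → Bool
radLt u v = (length u <ᵇ length v) ∨ ((length u ≡ᵇ length v) ∧ lexLt u v)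

count : {X : Set} → (X → Bool) → List X → ℕ
count p []       = 0
count p (x ∷ xs) = if p x then suc (count p xs) else count p xs

wordsUpTo : (k : ℕ) → ℕ → List (List (Fin k))
wordsUpTo k ℓ = concatMap (allWords k) (upTo (suc ℓ))

-- Rep S n w  :⇔  w = rep_S(n), i.e. w ∈ L and exactly n words of L are
-- radix-smaller than w (w is the n-th word of L, indexing from 0).
Rep : (S : ANS) → ℕ → List (Fin (ANS.k S)) → Set
Rep S n w = T (inL S w) × count (λ v → inL S v ∧ radLt v w) (wordsUpTo (ANS.k S) (length w)) ≡ n

Sym : ANS → Set
Sym S = Maybe (Fin (ANS.k S))        -- nothing plays the role of #

Word : ANS → Set
Word S = List (Fin (ANS.k S))

AllHash : {e : ℕ} {Ss : Vec ANS e} → All Sym Ss → Set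
AllHash []ₐ       = ⊤
AllHash (x ∷ₐ xs) = x ≡ nothing × AllHash xs

-- the alphabet B = (B₁ ∪ {#}) × ⋯ × (B_e ∪ {#}) minus (#,…,#)
Letter : {e : ℕ} → Vec ANS e → Set
Letter Ss = Σ (All Sym Ss) λ a → ¬ AllHash a

maxLen : {e : ℕ} {Ss : Vec ANS e} → All Word Ss → ℕ
maxLen []ₐ       = 0
maxLen (w ∷ₐ ws) = length w ⊔ maxLen ws

pad : {X : Set} → ℕ → List X → List (Maybe X)
pad m w = replicate (m ∸ length w) nothing ++ map just w

nth : {X : Set} → ℕ → List (Maybe X) → Maybe X
nth i       []       = nothing
nth zero    (x ∷ xs) = x
nth (suc i) (x ∷ xs) = nth i xs

column : {e : ℕ} {Ss : Vec ANS e} → ℕ → ℕ → All Word Ss → All Sym Ss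
column m i []ₐ       = []ₐ
column m i (w ∷ₐ ws) = nth i (pad m w) ∷ₐ column m i ws

parallel : {e : ℕ} {Ss : Vec ANS e} → All Word Ss → List (All Sym Ss)
parallel ws = map (λ i → column (maxLen ws) i ws) (upTo (maxLen ws))

RepAll : {e : ℕ} (Ss : Vec ANS e) → Vec ℕ e → All Word Ss → Set
RepAll []ᵥ        []ᵥ        []ₐ       = ⊤
RepAll (S ∷ᵥ Ss) (n ∷ᵥ ns) (w ∷ₐ ws) = Rep S n w × RepAll Ss ns ws

RepV : {e : ℕ} (Ss : Vec ANS e) → Vec ℕ e → List (Letter Ss) → Set
RepV Ss ns w = Σ (All Word Ss) λ ws → RepAll Ss ns ws × map proj₁ w ≡ parallel ws

Recognizable : {e : ℕ} (Ss : Vec ANS e) → (Vec ℕ e → Set) → Set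
Recognizable Ss X =
  Σ (DFA (Letter Ss)) λ M → Σ (Fin (DFA.nQ M) → Bool) λ F →
    ∀ (w : List (Letter Ss)) →
      (Σ (Vec ℕ _) λ ns → X ns × RepV Ss ns w) ⇔ T (accepts M F w)

-- f is 𝓢-automatic (DFAO with output map τ into ℕ^{d'}; its output
-- alphabet τ(Q) is automatically finite)
Automatic : {d d' : ℕ} (Ss : Vec ANS d) → (Vec ℕ d → Vec ℕ d') → Set
Automatic {d} {d'} Ss f =
  Σ (DFA (Letter Ss)) λ M → Σ (Fin (DFA.nQ M) → Vec ℕ d') λ τ →
    ∀ (ns : Vec ℕ d) (w : List (Letter Ss)) → RepV Ss ns w → f ns ≡ τ (run M w)

Graph : {d d' : ℕ} → (Vec ℕ d → Vec ℕ d') → Vec ℕ (d + d') → Set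
Graph {d} f v = Σ (Vec ℕ d) λ ns → v ≡ ns ++ᵥ f ns

Synchronized : {d d' : ℕ} (Ss : Vec ANS d) (Ss' : Vec ANS d') → (Vec ℕ d → Vec ℕ d') → Set
Synchronized Ss Ss' f = Recognizable (Ss ++ᵥ Ss') (Graph f)

FiniteRange : {d d' : ℕ} → (Vec ℕ d → Vec ℕ d') → Set
FiniteRange {d} {d'} f = Σ (List (Vec ℕ d')) λ vs → ∀ (ns : Vec ℕ d) → f ns ∈ vs

-- Everything rests on rep being a bijection from ℕ onto L: the rank of a word (the number of smaller words
-- of L in radix order) is strictly increasing along L, and since L is infinite the successor of rep n is the
-- least word of L above it.
--
-- A DFAO (M, τ) for f has only the outputs τ q, so f has finite range. Its graph is recognized by running M
-- on the first d tracks (skipping #-columns) while checking that they are a valid padded representation, and,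
-- in parallel for every state q, checking that the last d′ tracks spell rep(τ q) after some #-columns.
--
-- Conversely, let M recognize the graph and vs list the values of f. After a prefix p of rep(n) a DFAO stores,
-- for every v in vs and every prefix r of rep(v), the state M reaches on p and r read in parallel (right-aligned).
-- Appending a letter to p extends each aligned pair by one letter, so these states can be updated, and f(n) is
-- the v whose complete pair is accepted.

module Submission where

open import Defs
open import Data.Nat using (ℕ; zero; suc; _+_; _*_; _∸_; _⊔_; _≤_; _<_; z≤n; s≤s)
open import Data.Nat.Properties
open import Data.Fin using (Fin; toℕ; combine; remQuot) renaming (zero to fzero; suc to fsuc)
open import Data.Fin.Properties using (toℕ-injective; remQuot-combine) renaming (_≟_ to _≟ᶠ_)
open import Data.Bool using (Bool; true; false; _∧_; _∨_; if_then_else_; T)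
open import Data.Bool.Properties using (T-∨; T-∧; T-≡; ∧-zeroʳ)
open import Data.List using (List; []; _∷_; [_]; _++_; _∷ʳ_; length; map; replicate; reverse; concatMap; upTo; allFin; applyUpTo; foldl)
open import Data.List.Properties
open import Data.List.Membership.Propositional using (_∈_)
open import Data.List.Membership.Propositional.Properties using (∈-++⁻; ∈-map⁻; ∈-map⁺; ∈-allFin)
open import Data.List.Relation.Unary.Any using (here; there)
import Data.List.Relation.Unary.All as Allᴸ
open Allᴸ using () renaming (All to Allᴸ)
open import Data.List.Relation.Unary.All.Properties using (lookup-map)
open import Data.Vec.Properties using (++-injectiveˡ; ++-injectiveʳ)
open import Data.Maybe using (Maybe; just; nothing)
import Data.Maybe as Maybe
import Data.Maybe.Properties as Maybe
open import Data.Vec using (Vec) renaming ([] to []ᵥ; _∷_ to _∷ᵥ_; _++_ to _++ᵥ_; replicate to replicateᵥ)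
open import Data.Vec.Relation.Unary.All using (All; head; tail) renaming ([] to []ₐ; _∷_ to _∷ₐ_)
open import Data.Vec.Relation.Unary.All.Properties using (++⁺; ++ˡ⁻; ++ʳ⁻)
open import Data.Product using (Σ; _×_; _,_; proj₁; proj₂; map₁; uncurry)
open import Data.Sum using (_⊎_; inj₁; inj₂)
open import Data.Empty using (⊥-elim)
open import Data.Unit using (⊤; tt)
open import Relation.Nullary using (¬_; Dec; yes; no; does)
open import Relation.Binary.Definitions using (DecidableEquality; tri<; tri≈; tri>)
open import Relation.Binary.PropositionalEquality hiding ([_])
open import Function.Base using (id; _∘_)
open import Function.Bundles using (Equivalence; mk⇔; _⇔_)

open Equivalence using (to; from)

¬T⇒≡false : ∀ {b} → ¬ T b → b ≡ false
¬T⇒≡false {false} _  = refl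
¬T⇒≡false {true}  ¬t = ⊥-elim (¬t tt)

T-extensional : ∀ {a b} → (T a → T b) → (T b → T a) → a ≡ b
T-extensional {false} {false} _ _ = refl
T-extensional {false} {true}  _ g = ⊥-elim (g tt)
T-extensional {true}  {false} f _ = ⊥-elim (f tt)
T-extensional {true}  {true}  _ _ = refl

-- Radix order

module _ {k : ℕ} where

  infix 4 _<lex_ _<rad_

  data _<lex_ : List (Fin k) → List (Fin k) → Set where
    []<∷  : ∀ {b v} → [] <lex b ∷ v
    head< : ∀ {a b u v} → toℕ a < toℕ b → a ∷ u <lex b ∷ v
    tail< : ∀ {a u v} → u <lex v → a ∷ u <lex a ∷ v

  lexLt⇒<lex : ∀ u v → T (lexLt u v) → u <lex v
  lexLt⇒<lex []      (b ∷ v) _ = []<∷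
  lexLt⇒<lex (a ∷ u) (b ∷ v) t with to T-∨ t
  ... | inj₁ a<b = head< (<ᵇ⇒< _ _ a<b)
  ... | inj₂ a≡b∧u<v with to T-∧ a≡b∧u<v
  ... | a≡b , u<v with toℕ-injective {i = a} {j = b} (≡ᵇ⇒≡ _ _ a≡b)
  ... | refl = tail< (lexLt⇒<lex u v u<v)

  <lex⇒lexLt : ∀ {u v} → u <lex v → T (lexLt u v)
  <lex⇒lexLt []<∷         = tt
  <lex⇒lexLt (head< a<b)  = from T-∨ (inj₁ (<⇒<ᵇ a<b))
  <lex⇒lexLt {a ∷ _} (tail< u<v) = from T-∨ (inj₂ (from T-∧ (≡⇒≡ᵇ (toℕ a) (toℕ a) refl , <lex⇒lexLt u<v)))

  <lex-irrefl : ∀ {u} → ¬ u <lex u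
  <lex-irrefl (head< a<a) = <-irrefl refl a<a
  <lex-irrefl (tail< u<u) = <lex-irrefl u<u

  <lex-trans : ∀ {u v w} → u <lex v → v <lex w → u <lex w
  <lex-trans []<∷        (head< _)   = []<∷
  <lex-trans []<∷        (tail< _)   = []<∷
  <lex-trans (head< a<b) (head< b<c) = head< (<-trans a<b b<c)
  <lex-trans (head< a<b) (tail< _)   = head< a<b
  <lex-trans (tail< _)   (head< b<c) = head< b<c
  <lex-trans (tail< u<v) (tail< v<w) = tail< (<lex-trans u<v v<w)

  <lex-connex : ∀ u v → u ≢ v → u <lex v ⊎ v <lex u
  <lex-connex []      []      u≢v = ⊥-elim (u≢v refl)
  <lex-connex []      (_ ∷ _) _   = inj₁ []<∷
  <lex-connex (_ ∷ _) []      _   = inj₂ []<∷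
  <lex-connex (a ∷ u) (b ∷ v) u≢v with <-cmp (toℕ a) (toℕ b)
  ... | tri< a<b _ _ = inj₁ (head< a<b)
  ... | tri> _ _ b<a = inj₂ (head< b<a)
  ... | tri≈ _ a≡b _ with toℕ-injective a≡b
  ... | refl with <lex-connex u v (λ u≡v → u≢v (cong (a ∷_) u≡v))
  ... | inj₁ u<v = inj₁ (tail< u<v)
  ... | inj₂ v<u = inj₂ (tail< v<u)

  _<rad_ : List (Fin k) → List (Fin k) → Set
  u <rad v = length u < length v ⊎ (length u ≡ length v × u <lex v)

  radLt⇒<rad : ∀ u v → T (radLt u v) → u <rad v
  radLt⇒<rad u v t with to T-∨ t
  ... | inj₁ shorter = inj₁ (<ᵇ⇒< _ _ shorter)
  ... | inj₂ sameLength∧lex with to T-∧ sameLength∧lex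
  ... | |u|≡|v| , u<v = inj₂ (≡ᵇ⇒≡ _ _ |u|≡|v| , lexLt⇒<lex u v u<v)

  <rad⇒radLt : ∀ {u v} → u <rad v → T (radLt u v)
  <rad⇒radLt (inj₁ shorter) = from T-∨ (inj₁ (<⇒<ᵇ shorter))
  <rad⇒radLt {u} {v} (inj₂ (|u|≡|v| , u<v)) =
    from T-∨ (inj₂ (from T-∧ (≡⇒≡ᵇ (length u) (length v) |u|≡|v| , <lex⇒lexLt u<v)))

  <rad-irrefl : ∀ {u} → ¬ u <rad u
  <rad-irrefl (inj₁ |u|<|u|)   = <-irrefl refl |u|<|u|
  <rad-irrefl (inj₂ (_ , u<u)) = <lex-irrefl u<u

  <rad-trans : ∀ {u v w} → u <rad v → v <rad w → u <rad w
  <rad-trans (inj₁ p)       (inj₁ q)        = inj₁ (<-trans p q)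
  <rad-trans (inj₁ p)       (inj₂ (e , _))  = inj₁ (subst (_ <_) e p)
  <rad-trans (inj₂ (e , _)) (inj₁ q)        = inj₁ (subst (_< _) (sym e) q)
  <rad-trans (inj₂ (e , p)) (inj₂ (e′ , q)) = inj₂ (trans e e′ , <lex-trans p q)

  <rad-connex : ∀ u v → u ≢ v → u <rad v ⊎ v <rad u
  <rad-connex u v u≢v with <-cmp (length u) (length v)
  ... | tri< shorter _ _ = inj₁ (inj₁ shorter)
  ... | tri> _ _ longer  = inj₂ (inj₁ longer)
  ... | tri≈ _ e _ with <lex-connex u v u≢v
  ... | inj₁ u<v = inj₁ (inj₂ (e , u<v))
  ... | inj₂ v<u = inj₂ (inj₂ (sym e , v<u))

  <rad⇒length≤ : ∀ {u v} → u <rad v → length u ≤ length v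
  <rad⇒length≤ (inj₁ shorter) = <⇒≤ shorter
  <rad⇒length≤ (inj₂ (e , _)) = ≤-reflexive e

  radLt-longer : ∀ u v → length v < length u → radLt u v ≡ false
  radLt-longer u v longer =
    ¬T⇒≡false (λ t → <⇒≱ longer (<rad⇒length≤ (radLt⇒<rad u v t)))

module _ {X : Set} where

  count-++ : ∀ (p : X → Bool) xs ys → count p (xs ++ ys) ≡ count p xs + count p ys
  count-++ p []       ys = refl
  count-++ p (x ∷ xs) ys with p x
  ... | true  = cong suc (count-++ p xs ys)
  ... | false = count-++ p xs ys

  count-cong : ∀ {p q : X → Bool} → (∀ x → p x ≡ q x) → ∀ xs → count p xs ≡ count q xs
  count-cong p≗q []       = refl
  count-cong {p} {q} p≗q (x ∷ xs) rewrite p≗q x with q x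
  ... | true  = cong suc (count-cong p≗q xs)
  ... | false = count-cong p≗q xs

  count-∨ : ∀ (p q : X → Bool) → (∀ x → T (p x) → ¬ T (q x)) → ∀ xs →
            count (λ x → p x ∨ q x) xs ≡ count p xs + count q xs
  count-∨ p q disjoint []       = refl
  count-∨ p q disjoint (x ∷ xs) with p x in px | q x in qx
  ... | true  | true  = ⊥-elim (disjoint x (from T-≡ px) (from T-≡ qx))
  ... | true  | false = cong suc (count-∨ p q disjoint xs)
  ... | false | true  = trans (cong suc (count-∨ p q disjoint xs)) (sym (+-suc _ _))
  ... | false | false = count-∨ p q disjoint xs

  count-mono : ∀ (p q : X → Bool) → (∀ x → T (p x) → T (q x)) → ∀ xs → count p xs ≤ count q xs
  count-mono p q p⇒q []       = z≤n
  count-mono p q p⇒q (x ∷ xs) with p x in px | q x in qx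
  ... | true  | true  = s≤s (count-mono p q p⇒q xs)
  ... | true  | false = ⊥-elim (subst T qx (p⇒q x (from T-≡ px)))
  ... | false | true  = m≤n⇒m≤1+n (count-mono p q p⇒q xs)
  ... | false | false = count-mono p q p⇒q xs

  count-none : ∀ (p : X → Bool) xs → (∀ x → x ∈ xs → p x ≡ false) → count p xs ≡ 0
  count-none p []       _    = refl
  count-none p (x ∷ xs) none rewrite none x (here refl) = count-none p xs (λ y y∈xs → none y (there y∈xs))

  count-pos : ∀ (p : X → Bool) xs → 0 < count p xs → Σ X λ x → x ∈ xs × T (p x)
  count-pos p (x ∷ xs) pos with p x in px
  ... | true  = x , here refl , from T-≡ px
  ... | false with count-pos p xs pos
  ... | y , y∈xs , py = y , there y∈xs , py

  count-map : ∀ {Y : Set} (p : Y → Bool) (f : X → Y) xs → count p (map f xs) ≡ count (λ x → p (f x)) xs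
  count-map p f []       = refl
  count-map p f (x ∷ xs) with p (f x)
  ... | true  = cong suc (count-map p f xs)
  ... | false = count-map p f xs

module _ {X : Set} (_≟_ : DecidableEquality X) where

  _==_ : X → X → Bool
  x == y = does (x ≟ y)

  ==⇒≡ : ∀ {x y} → T (x == y) → x ≡ y
  ==⇒≡ {x} {y} t with x ≟ y
  ... | yes x≡y = x≡y

  ==-refl : ∀ x → x == x ≡ true
  ==-refl x with x ≟ x
  ... | yes _   = refl
  ... | no  x≢x = ⊥-elim (x≢x refl)

  ≢⇒==false : ∀ {x y} → x ≢ y → x == y ≡ false
  ≢⇒==false {x} {y} x≢y with x ≟ y
  ... | yes x≡y = ⊥-elim (x≢y x≡y)
  ... | no  _   = refl

module _ {k : ℕ} where

  _≟ʷ_ : DecidableEquality (List (Fin k))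
  _≟ʷ_ = ≡-dec _≟ᶠ_

  _==ᶠ_ : Fin k → Fin k → Bool
  _==ᶠ_ = _==_ _≟ᶠ_

  _==ʷ_ : List (Fin k) → List (Fin k) → Bool
  _==ʷ_ = _==_ _≟ʷ_

  ∷==ʷ∷ : ∀ b w a v → (b ∷ w) ==ʷ (a ∷ v) ≡ (b ==ᶠ a) ∧ (w ==ʷ v)
  ∷==ʷ∷ b w a v with b ≟ᶠ a | w ≟ʷ v
  ... | yes refl | yes refl = refl
  ... | yes refl | no _     = refl
  ... | no _     | _        = refl

count-==-allFin : ∀ {k} (b : Fin k) → count (b ==ᶠ_) (allFin k) ≡ 1
count-==-allFin {suc k} b = trans (cong (λ xs → count (b ==ᶠ_) (fzero ∷ xs)) (sym (map-tabulate id fsuc))) (go b)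
  where
  go : ∀ b → count (b ==ᶠ_) (fzero ∷ map fsuc (allFin k)) ≡ 1
  go fzero    = cong suc (trans (count-map _ fsuc (allFin k)) (count-none _ (allFin k) (λ _ _ → refl)))
  go (fsuc b) = trans (count-map _ fsuc (allFin k)) (count-==-allFin b)

module _ {k : ℕ} where

  allWords-length : ∀ ℓ {v} → v ∈ allWords k ℓ → length v ≡ ℓ
  allWords-length zero    (here refl) = refl
  allWords-length (suc ℓ) v∈         = go (allFin k) v∈
    where
    go : ∀ {v} as → v ∈ concatMap (λ a → map (a ∷_) (allWords k ℓ)) as → length v ≡ suc ℓ
    go (a ∷ as) v∈ with ∈-++⁻ (map (a ∷_) (allWords k ℓ)) v∈
    ... | inj₂ v∈rest = go as v∈rest
    ... | inj₁ v∈aWs with ∈-map⁻ (a ∷_) v∈aWs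
    ... | v′ , v′∈ , refl = cong suc (allWords-length ℓ v′∈)

  count-∷-concatMap : ∀ b w (as : List (Fin k)) →
    count ((b ∷ w) ==ʷ_) (concatMap (λ a → map (a ∷_) (allWords k (length w))) as)
    ≡ count (b ==ᶠ_) as * count (w ==ʷ_) (allWords k (length w))
  count-∷-concatMap b w []       = refl
  count-∷-concatMap b w (a ∷ as) = begin
      count ((b ∷ w) ==ʷ_) (map (a ∷_) Ws ++ rest)
    ≡⟨ count-++ _ (map (a ∷_) Ws) rest ⟩
      count ((b ∷ w) ==ʷ_) (map (a ∷_) Ws) + count ((b ∷ w) ==ʷ_) rest
    ≡⟨ cong₂ _+_ (trans (count-map _ _ Ws) (count-cong (∷==ʷ∷ b w a) Ws)) (count-∷-concatMap b w as) ⟩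
      count (λ v → (b ==ᶠ a) ∧ (w ==ʷ v)) Ws + count (b ==ᶠ_) as * count (w ==ʷ_) Ws
    ≡⟨ split (b ==ᶠ a) ⟩
      count (b ==ᶠ_) (a ∷ as) * count (w ==ʷ_) Ws ∎
    where
    open ≡-Reasoning
    Ws : List (List (Fin k))
    Ws = allWords k (length w)
    rest : List (List (Fin k))
    rest = concatMap (λ a → map (a ∷_) Ws) as
    split : ∀ c → count (λ v → c ∧ (w ==ʷ v)) Ws + count (b ==ᶠ_) as * count (w ==ʷ_) Ws
                ≡ (if c then suc (count (b ==ᶠ_) as) else count (b ==ᶠ_) as) * count (w ==ʷ_) Ws
    split true  = refl
    split false = cong (_+ count (b ==ᶠ_) as * count (w ==ʷ_) Ws) (count-none _ Ws (λ _ _ → refl))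

  count-==-allWords : ∀ w → count (w ==ʷ_) (allWords k (length w)) ≡ 1
  count-==-allWords []      = refl
  count-==-allWords (b ∷ w) =
    trans (count-∷-concatMap b w (allFin k)) (cong₂ _*_ (count-==-allFin b) (count-==-allWords w))

  wordsUpTo-suc : ∀ ℓ → wordsUpTo k (suc ℓ) ≡ wordsUpTo k ℓ ++ allWords k (suc ℓ)
  wordsUpTo-suc ℓ = begin
      concatMap (allWords k) (upTo (suc (suc ℓ)))
    ≡⟨ cong (concatMap (allWords k)) (sym (upTo-∷ʳ (suc ℓ))) ⟩
      concatMap (allWords k) (upTo (suc ℓ) ++ [ suc ℓ ])
    ≡⟨ concatMap-++ (allWords k) (upTo (suc ℓ)) [ suc ℓ ] ⟩
      wordsUpTo k ℓ ++ (allWords k (suc ℓ) ++ [])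
    ≡⟨ cong (wordsUpTo k ℓ ++_) (++-identityʳ _) ⟩
      wordsUpTo k ℓ ++ allWords k (suc ℓ) ∎
    where open ≡-Reasoning

  wordsUpTo-length≤ : ∀ ℓ {v} → v ∈ wordsUpTo k ℓ → length v ≤ ℓ
  wordsUpTo-length≤ zero v∈ with ∈-++⁻ (allWords k 0) v∈
  ... | inj₁ v∈₀ = ≤-reflexive (allWords-length 0 v∈₀)
  ... | inj₂ ()
  wordsUpTo-length≤ (suc ℓ) {v} v∈ with ∈-++⁻ (wordsUpTo k ℓ) (subst (v ∈_) (wordsUpTo-suc ℓ) v∈)
  ... | inj₁ v∈shorter = m≤n⇒m≤1+n (wordsUpTo-length≤ ℓ v∈shorter)
  ... | inj₂ v∈longest = ≤-reflexive (allWords-length (suc ℓ) v∈longest)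

  count-==-wordsUpTo : ∀ ℓ w → length w ≤ ℓ → count (w ==ʷ_) (wordsUpTo k ℓ) ≡ 1
  count-==-wordsUpTo zero    [] _ = refl
  count-==-wordsUpTo (suc ℓ) w |w|≤ =
    trans (cong (count (w ==ʷ_)) (wordsUpTo-suc ℓ))
          (trans (count-++ _ (wordsUpTo k ℓ) _) (split (m≤n⇒m<n∨m≡n |w|≤)))
    where
    split : length w < suc ℓ ⊎ length w ≡ suc ℓ →
            count (w ==ʷ_) (wordsUpTo k ℓ) + count (w ==ʷ_) (allWords k (suc ℓ)) ≡ 1
    split (inj₁ shorter) = cong₂ _+_ (count-==-wordsUpTo ℓ w (≤-pred shorter))
      (count-none _ _ λ v v∈ → ≢⇒==false _≟ʷ_ {w} {v} λ w≡v →
        <-irrefl (trans (cong length w≡v) (allWords-length (suc ℓ) v∈)) shorter)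
    split (inj₂ longest) = cong₂ _+_
      (count-none _ _ λ v v∈ → ≢⇒==false _≟ʷ_ {w} {v} λ w≡v →
        <-irrefl (trans (sym (cong length w≡v)) longest) (s≤s (wordsUpTo-length≤ ℓ v∈)))
      (subst (λ n → count (w ==ʷ_) (allWords k n) ≡ 1) longest (count-==-allWords w))

  ∈-wordsUpTo : ∀ ℓ w → length w ≤ ℓ → w ∈ wordsUpTo k ℓ
  ∈-wordsUpTo ℓ w |w|≤ with count-pos (w ==ʷ_) (wordsUpTo k ℓ) (≤-reflexive (sym (count-==-wordsUpTo ℓ w |w|≤)))
  ... | v , v∈ , w==v with ==⇒≡ _≟ʷ_ {w} {v} w==v
  ... | refl = v∈

  count-wordsUpTo-+ : ∀ (p : List (Fin k) → Bool) ℓ t → (∀ v → ℓ < length v → p v ≡ false) →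
                      count p (wordsUpTo k ℓ) ≡ count p (wordsUpTo k (t + ℓ))
  count-wordsUpTo-+ p ℓ zero    _        = refl
  count-wordsUpTo-+ p ℓ (suc t) longer⇒¬p = begin
      count p (wordsUpTo k ℓ)
    ≡⟨ count-wordsUpTo-+ p ℓ t longer⇒¬p ⟩
      count p (wordsUpTo k (t + ℓ))
    ≡⟨ sym (+-identityʳ _) ⟩
      count p (wordsUpTo k (t + ℓ)) + 0
    ≡⟨ cong (count p (wordsUpTo k (t + ℓ)) +_) (sym (count-none p _ λ v v∈ →
         longer⇒¬p v (subst (ℓ <_) (sym (allWords-length _ v∈)) (s≤s (m≤n+m ℓ t))))) ⟩
      count p (wordsUpTo k (t + ℓ)) + count p (allWords k (suc t + ℓ))
    ≡⟨ sym (count-++ p (wordsUpTo k (t + ℓ)) _) ⟩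
      count p (wordsUpTo k (t + ℓ) ++ allWords k (suc t + ℓ))
    ≡⟨ cong (count p) (sym (wordsUpTo-suc (t + ℓ))) ⟩
      count p (wordsUpTo k (suc t + ℓ)) ∎
    where open ≡-Reasoning

-- The representation map of an abstract numeration system

module _ {k : ℕ} where

  Least : (List (Fin k) → Bool) → List (Fin k) → Set
  Least q m = T (q m) × (∀ v → T (q v) → ¬ v <rad m)

  selectMin : (List (Fin k) → Bool) → List (Fin k) → List (List (Fin k)) → List (Fin k)
  selectMin q a []       = a
  selectMin q a (x ∷ xs) = selectMin q (if q x ∧ radLt x a then x else a) xs

  LeastAmong : (List (Fin k) → Bool) → List (List (Fin k)) → List (Fin k) → Set
  LeastAmong q xs m = T (q m) × (∀ v → v ∈ xs → T (q v) → ¬ v <rad m)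

  selectMin-least : ∀ q a xs → T (q a) → LeastAmong q (a ∷ xs) (selectMin q a xs)
  selectMin-least q a []       qa = qa , λ { v (here refl) _ v<v → <rad-irrefl v<v }
  selectMin-least q a (x ∷ xs) qa with q x ∧ radLt x a in x-better
  ... | true = least-x (to T-∧ (from T-≡ x-better))
    where
    least-x : T (q x) × T (radLt x a) → LeastAmong q (a ∷ x ∷ xs) (selectMin q x xs)
    least-x (qx , x<a) with selectMin-least q x xs qx
    ... | qm , m-least = qm , λ where
      v (here refl) _  v<m → m-least x (here refl) qx (<rad-trans (radLt⇒<rad x a x<a) v<m)
      v (there v∈)  qv v<m → m-least v v∈ qv v<m
  ... | false with selectMin-least q a xs qa
  ... | qm , m-least = qm , minimal
    where
    m : List (Fin k)
    m = selectMin q a xs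
    x≮a : T (q x) → ¬ x <rad a
    x≮a qx x<a = subst T x-better (from T-∧ (qx , <rad⇒radLt x<a))
    minimal : ∀ v → v ∈ a ∷ x ∷ xs → T (q v) → ¬ v <rad m
    minimal v (here refl)          qv v<m = m-least a (here refl) qv v<m
    minimal v (there (there v∈xs)) qv v<m = m-least v (there v∈xs) qv v<m
    minimal v (there (here refl))  qv v<m with m ≟ʷ a
    ... | yes m≡a = x≮a qv (subst (v <rad_) m≡a v<m)
    ... | no m≢a with <rad-connex a m (m≢a ∘ sym)
    ... | inj₁ a<m = m-least a (here refl) qa a<m
    ... | inj₂ m<a = x≮a qv (<rad-trans v<m m<a)

  -- A word below the least witness is no longer than u, so searching wordsUpTo k (length u) suffices.
  least : ∀ q u → T (q u) → Σ (List (Fin k)) (Least q)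
  least q u qu with selectMin-least q u (wordsUpTo k (length u)) qu
  ... | qm , m-least = m , qm , λ v qv v<m →
    m-least v (there (∈-wordsUpTo (length u) v (≤-trans (<rad⇒length≤ v<m) |m|≤|u|))) qv v<m
    where
    m : List (Fin k)
    m = selectMin q u (wordsUpTo k (length u))
    |m|≤|u| : length m ≤ length u
    |m|≤|u| with m ≟ʷ u
    ... | yes m≡u = ≤-reflexive (cong length m≡u)
    ... | no m≢u with <rad-connex u m (m≢u ∘ sym)
    ... | inj₁ u<m = ⊥-elim (m-least u (here refl) qu u<m)
    ... | inj₂ m<u = <rad⇒length≤ m<u

module _ (S : ANS) where

  private
    k : ℕ
    k = ANS.k S

  belowIn : Word S → Word S → Bool
  belowIn x v = inL S v ∧ radLt v x

  belowIn⇒ : ∀ x v → T (belowIn x v) → T (inL S v) × v <rad x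
  belowIn⇒ x v t with to (T-∧ {inL S v}) t
  ... | v∈L , v<x = v∈L , radLt⇒<rad v x v<x

  ⇒belowIn : ∀ x v → T (inL S v) → v <rad x → T (belowIn x v)
  ⇒belowIn x v v∈L v<x = from T-∧ (v∈L , <rad⇒radLt v<x)

  aboveIn : Word S → Word S → Bool
  aboveIn x v = inL S v ∧ radLt x v

  aboveIn⇒ : ∀ x v → T (aboveIn x v) → T (inL S v) × x <rad v
  aboveIn⇒ x v t with to (T-∧ {inL S v}) t
  ... | v∈L , x<v = v∈L , radLt⇒<rad x v x<v

  ⇒aboveIn : ∀ x v → T (inL S v) → x <rad v → T (aboveIn x v)
  ⇒aboveIn x v v∈L x<v = from T-∧ (v∈L , <rad⇒radLt x<v)

  atMostIn : Word S → Word S → Bool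
  atMostIn x v = belowIn x v ∨ (x ==ʷ v)

  rank : Word S → ℕ
  rank x = count (belowIn x) (wordsUpTo k (length x))

  count-atMostIn : ∀ x ℓ → T (inL S x) → length x ≤ ℓ → count (atMostIn x) (wordsUpTo k ℓ) ≡ suc (rank x)
  count-atMostIn x ℓ x∈L |x|≤ℓ = begin
      count (atMostIn x) (wordsUpTo k ℓ)
    ≡⟨ count-∨ (belowIn x) (x ==ʷ_) disjoint (wordsUpTo k ℓ) ⟩
      count (belowIn x) (wordsUpTo k ℓ) + count (x ==ʷ_) (wordsUpTo k ℓ)
    ≡⟨ cong₂ _+_ (sym (trans (count-wordsUpTo-+ (belowIn x) (length x) (ℓ ∸ length x) longer⇒¬below)
                             (cong (count (belowIn x) ∘ wordsUpTo k) (m∸n+n≡m |x|≤ℓ))))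
                 (count-==-wordsUpTo ℓ x |x|≤ℓ) ⟩
      rank x + 1
    ≡⟨ +-comm (rank x) 1 ⟩
      suc (rank x) ∎
    where
    open ≡-Reasoning
    disjoint : ∀ v → T (belowIn x v) → ¬ T (x ==ʷ v)
    disjoint v v<x x==v with ==⇒≡ _≟ʷ_ {x} {v} x==v
    ... | refl = <rad-irrefl (proj₂ (belowIn⇒ x v v<x))
    longer⇒¬below : ∀ v → length x < length v → belowIn x v ≡ false
    longer⇒¬below v longer rewrite radLt-longer v x longer = ∧-zeroʳ (inL S v)

  rank-< : ∀ {x y} → T (inL S x) → x <rad y → rank x < rank y
  rank-< {x} {y} x∈L x<y = subst (_≤ rank y) (count-atMostIn x (length y) x∈L (<rad⇒length≤ x<y))
    (count-mono (atMostIn x) (belowIn y) atMost⇒below (wordsUpTo k (length y)))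
    where
    atMost⇒below : ∀ v → T (atMostIn x v) → T (belowIn y v)
    atMost⇒below v t with to T-∨ t
    ... | inj₁ v<x = ⇒belowIn y v (proj₁ (belowIn⇒ x v v<x)) (<rad-trans (proj₂ (belowIn⇒ x v v<x)) x<y)
    ... | inj₂ x==v with ==⇒≡ _≟ʷ_ {x} {v} x==v
    ... | refl = ⇒belowIn y x x∈L x<y

  Rep-unique : ∀ {n w w′} → Rep S n w → Rep S n w′ → w ≡ w′
  Rep-unique {n} {w} {w′} (w∈L , rank-w) (w′∈L , rank-w′) with w ≟ʷ w′
  ... | yes w≡w′ = w≡w′
  ... | no w≢w′ with <rad-connex w w′ w≢w′
  ... | inj₁ w<w′ = ⊥-elim (<-irrefl refl (subst₂ _<_ rank-w rank-w′ (rank-< w∈L w<w′)))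
  ... | inj₂ w′<w = ⊥-elim (<-irrefl refl (subst₂ _<_ rank-w′ rank-w (rank-< w′∈L w′<w)))

  belowIn-successor : ∀ {w m} → T (inL S w) → Least (aboveIn w) m →
                      ∀ v → belowIn m v ≡ atMostIn w v
  belowIn-successor {w} {m} w∈L (m∈L×w<m , m-least) v = T-extensional ⇒ ⇐
    where
    w<m : w <rad m
    w<m = proj₂ (aboveIn⇒ w m m∈L×w<m)
    ⇒ : T (belowIn m v) → T (atMostIn w v)
    ⇒ t with w ≟ʷ v | belowIn⇒ m v t
    ... | yes refl | _ = from (T-∨ {belowIn w w}) (inj₂ tt)
    ... | no w≢v | v∈L , v<m with <rad-connex v w (w≢v ∘ sym)
    ... | inj₁ v<w = from (T-∨ {belowIn w v}) (inj₁ (⇒belowIn w v v∈L v<w))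
    ... | inj₂ w<v = ⊥-elim (m-least v (⇒aboveIn w v v∈L w<v) v<m)
    ⇐ : T (atMostIn w v) → T (belowIn m v)
    ⇐ t with to T-∨ t
    ... | inj₁ v<w = ⇒belowIn m v (proj₁ (belowIn⇒ w v v<w)) (<rad-trans (proj₂ (belowIn⇒ w v v<w)) w<m)
    ... | inj₂ w==v with ==⇒≡ _≟ʷ_ {w} {v} w==v
    ... | refl = ⇒belowIn m w w∈L w<m

  rep : ∀ n → Σ (Word S) (Rep S n)
  rep zero with ANS.infinite S 0
  ... | u , _ , u∈L with least (inL S) u u∈L
  ... | m , m∈L , m-least = m , m∈L , count-none (belowIn m) (wordsUpTo k (length m)) nothing-below
    where
    nothing-below : ∀ v → v ∈ wordsUpTo k (length m) → belowIn m v ≡ false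
    nothing-below v _ = ¬T⇒≡false λ t → uncurry (m-least v) (belowIn⇒ m v t)
  rep (suc n) with rep n
  ... | w , w∈L , rank-w with ANS.infinite S (suc (length w))
  ... | u , |w|<|u| , u∈L with least (aboveIn w) u (⇒aboveIn w u u∈L (inj₁ |w|<|u|))
  ... | m , m-least = m , proj₁ (aboveIn⇒ w m (proj₁ m-least)) , (begin
      rank m                                      ≡⟨ count-cong (belowIn-successor w∈L m-least) (wordsUpTo k (length m)) ⟩
      count (atMostIn w) (wordsUpTo k (length m)) ≡⟨ count-atMostIn w (length m) w∈L (<rad⇒length≤ w<m) ⟩
      suc (rank w)                                ≡⟨ cong suc rank-w ⟩
      suc n                                       ∎)
    where
    open ≡-Reasoning
    w<m : w <rad m
    w<m = proj₂ (aboveIn⇒ w m (proj₁ m-least))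

-- Reading words in parallel

Tracks : ∀ {e} → Vec ANS e → Set
Tracks = All (λ S → List (Sym S))

module _ {X : Set} where

  length-pad : ∀ m (w : List X) → length w ≤ m → length (pad m w) ≡ m
  length-pad m w |w|≤m = trans (length-++ (replicate (m ∸ length w) nothing))
    (trans (cong₂ _+_ (length-replicate (m ∸ length w)) (length-map just w)) (m∸n+n≡m |w|≤m))

  map-nth-upTo : ∀ (xs : List (Maybe X)) → map (λ i → nth i xs) (upTo (length xs)) ≡ xs
  map-nth-upTo xs = trans (map-upTo (λ i → nth i xs) (length xs)) (applyUpTo-nth xs)
    where
    applyUpTo-nth : ∀ (xs : List (Maybe X)) → applyUpTo (λ i → nth i xs) (length xs) ≡ xs
    applyUpTo-nth []       = refl
    applyUpTo-nth (x ∷ xs) = cong (x ∷_) (applyUpTo-nth xs)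

  map-nth-pad : ∀ m (w : List X) → length w ≤ m → map (λ i → nth i (pad m w)) (upTo m) ≡ pad m w
  map-nth-pad m w |w|≤m = subst (λ n → map (λ i → nth i (pad m w)) (upTo n) ≡ pad m w)
                                (length-pad m w |w|≤m) (map-nth-upTo (pad m w))

  replicate-+ : ∀ a b (x : X) → replicate a x ++ replicate b x ≡ replicate (a + b) x
  replicate-+ zero    b x = refl
  replicate-+ (suc a) b x = cong (x ∷_) (replicate-+ a b x)

  unpad : List (Maybe X) → List X
  unpad []             = []
  unpad (nothing ∷ xs) = unpad xs
  unpad (just x ∷ xs)  = x ∷ unpad xs

  unpad-pad : ∀ m (w : List X) → unpad (pad m w) ≡ w
  unpad-pad m w = unpad-hashes (m ∸ length w)
    where
    unpad-just : ∀ (w : List X) → unpad (map just w) ≡ w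
    unpad-just []      = refl
    unpad-just (x ∷ w) = cong (x ∷_) (unpad-just w)
    unpad-hashes : ∀ a → unpad (replicate a nothing ++ map just w) ≡ w
    unpad-hashes zero    = unpad-just w
    unpad-hashes (suc a) = unpad-hashes a

private
  variable
    e e₁ e₂ : ℕ
    Ss : Vec ANS e
    Ss₁ : Vec ANS e₁
    Ss₂ : Vec ANS e₂

tracks : List (All Sym Ss) → Tracks Ss
tracks {Ss = []ᵥ}     _ = []ₐ
tracks {Ss = S ∷ᵥ Ss} u = map head u ∷ₐ tracks (map tail u)

padEach : ℕ → All Word Ss → Tracks Ss
padEach m []ₐ       = []ₐ
padEach m (w ∷ₐ ws) = pad m w ∷ₐ padEach m ws

LengthsAtMost : ℕ → All Word Ss → Set
LengthsAtMost m []ₐ       = ⊤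
LengthsAtMost m (w ∷ₐ ws) = length w ≤ m × LengthsAtMost m ws

LengthsAtMost-mono : ∀ {m n} (ws : All Word Ss) → m ≤ n → LengthsAtMost m ws → LengthsAtMost n ws
LengthsAtMost-mono []ₐ       m≤n _              = tt
LengthsAtMost-mono (w ∷ₐ ws) m≤n (|w|≤m , fits) = ≤-trans |w|≤m m≤n , LengthsAtMost-mono ws m≤n fits

LengthsAtMost-maxLen : ∀ (ws : All Word Ss) → LengthsAtMost (maxLen ws) ws
LengthsAtMost-maxLen []ₐ       = tt
LengthsAtMost-maxLen (w ∷ₐ ws) = m≤m⊔n (length w) (maxLen ws) ,
  LengthsAtMost-mono ws (m≤n⊔m (length w) (maxLen ws)) (LengthsAtMost-maxLen ws)

maxLen-lub : ∀ m (ws : All Word Ss) → LengthsAtMost m ws → maxLen ws ≤ m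
maxLen-lub m []ₐ       _              = z≤n
maxLen-lub m (w ∷ₐ ws) (|w|≤m , fits) = ⊔-lub |w|≤m (maxLen-lub m ws fits)

tracks-columns : ∀ m (ws : All Word Ss) → LengthsAtMost m ws →
                 tracks (map (λ i → column m i ws) (upTo m)) ≡ padEach m ws
tracks-columns m []ₐ       _              = refl
tracks-columns m (w ∷ₐ ws) (|w|≤m , fits) = cong₂ _∷ₐ_
  (trans (sym (map-∘ (upTo m))) (map-nth-pad m w |w|≤m))
  (trans (cong tracks (sym (map-∘ (upTo m)))) (tracks-columns m ws fits))

tracks-parallel : ∀ (ws : All Word Ss) → tracks (parallel ws) ≡ padEach (maxLen ws) ws
tracks-parallel ws = tracks-columns (maxLen ws) ws (LengthsAtMost-maxLen ws)

length-parallel : ∀ (ws : All Word Ss) → length (parallel ws) ≡ maxLen ws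
length-parallel ws = trans (length-map _ (upTo (maxLen ws))) (length-upTo (maxLen ws))

tracks-injective : ∀ (u u′ : List (All Sym Ss)) → length u ≡ length u′ → tracks u ≡ tracks u′ → u ≡ u′
tracks-injective {Ss = []ᵥ}     []          []           _     _ = refl
tracks-injective {Ss = []ᵥ}     ([]ₐ ∷ u)   ([]ₐ ∷ u′)   |u|≡  _ =
  cong ([]ₐ ∷_) (tracks-injective u u′ (suc-injective |u|≡) refl)
tracks-injective {Ss = S ∷ᵥ Ss} u u′ |u|≡ tracks≡ =
  head×tail-injective u u′ (cong head tracks≡)
    (tracks-injective (map tail u) (map tail u′)
      (trans (length-map tail u) (trans |u|≡ (sym (length-map tail u′)))) (cong tail tracks≡))
  where
  head×tail-injective : ∀ (u u′ : List (All Sym (S ∷ᵥ Ss))) →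
                        map head u ≡ map head u′ → map tail u ≡ map tail u′ → u ≡ u′
  head×tail-injective []              []              _ _ = refl
  head×tail-injective ((x ∷ₐ xs) ∷ u) ((y ∷ₐ ys) ∷ u′) heads tails with ∷-injective heads | ∷-injective tails
  ... | refl , heads′ | refl , tails′ = cong ((x ∷ₐ xs) ∷_) (head×tail-injective u u′ heads′ tails′)

≡parallel : ∀ (u : List (All Sym Ss)) (ws : All Word Ss) → length u ≡ maxLen ws →
            tracks u ≡ padEach (length u) ws → u ≡ parallel ws
≡parallel u ws |u|≡ tracks≡ = tracks-injective u (parallel ws) (trans |u|≡ (sym (length-parallel ws)))
  (trans tracks≡ (trans (cong (λ n → padEach n ws) |u|≡) (sym (tracks-parallel ws))))

unpadEach : Tracks Ss → All Word Ss
unpadEach []ₐ       = []ₐ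
unpadEach (x ∷ₐ xs) = unpad x ∷ₐ unpadEach xs

unpadEach-padEach : ∀ m (ws : All Word Ss) → unpadEach (padEach m ws) ≡ ws
unpadEach-padEach m []ₐ       = refl
unpadEach-padEach m (w ∷ₐ ws) = cong₂ _∷ₐ_ (unpad-pad m w) (unpadEach-padEach m ws)

parallel-injective : ∀ (ws ws′ : All Word Ss) → parallel ws ≡ parallel ws′ → ws ≡ ws′
parallel-injective ws ws′ eq = begin
    ws                                         ≡⟨ sym (unpadEach-padEach (maxLen ws) ws) ⟩
    unpadEach (padEach (maxLen ws) ws)          ≡⟨ cong unpadEach (sym (tracks-parallel ws)) ⟩
    unpadEach (tracks (parallel ws))            ≡⟨ cong (unpadEach ∘ tracks) eq ⟩
    unpadEach (tracks (parallel ws′))           ≡⟨ cong unpadEach (tracks-parallel ws′) ⟩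
    unpadEach (padEach (maxLen ws′) ws′)        ≡⟨ unpadEach-padEach (maxLen ws′) ws′ ⟩
    ws′                                        ∎
  where open ≡-Reasoning

hashes : All Sym Ss
hashes {Ss = []ᵥ}     = []ₐ
hashes {Ss = S ∷ᵥ Ss} = nothing ∷ₐ hashes

AllHash-hashes : AllHash (hashes {Ss = Ss})
AllHash-hashes {Ss = []ᵥ}     = tt
AllHash-hashes {Ss = S ∷ᵥ Ss} = refl , AllHash-hashes

AllHash? : ∀ (a : All Sym Ss) → Dec (AllHash a)
AllHash? []ₐ = yes tt
AllHash? (just _ ∷ₐ a) = no λ { (() , _) }
AllHash? (nothing ∷ₐ a) with AllHash? a
... | yes hash-a = yes (refl , hash-a)
... | no ¬hash-a = no (¬hash-a ∘ proj₂)

_++ᵗ_ : Tracks Ss → Tracks Ss → Tracks Ss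
[]ₐ       ++ᵗ []ₐ       = []ₐ
(x ∷ₐ xs) ++ᵗ (y ∷ₐ ys) = (x ++ y) ∷ₐ (xs ++ᵗ ys)

hashTracks : ℕ → Tracks Ss
hashTracks {Ss = []ᵥ}     a = []ₐ
hashTracks {Ss = S ∷ᵥ Ss} a = replicate a nothing ∷ₐ hashTracks a

tracks-++ : ∀ (u u′ : List (All Sym Ss)) → tracks (u ++ u′) ≡ tracks u ++ᵗ tracks u′
tracks-++ {Ss = []ᵥ}     u u′ = refl
tracks-++ {Ss = S ∷ᵥ Ss} u u′ =
  cong₂ _∷ₐ_ (map-++ head u u′) (trans (cong tracks (map-++ tail u u′)) (tracks-++ (map tail u) (map tail u′)))

tracks-hashes : ∀ a → tracks (replicate a (hashes {Ss = Ss})) ≡ hashTracks a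
tracks-hashes {Ss = []ᵥ}     a = refl
tracks-hashes {Ss = S ∷ᵥ Ss} a =
  cong₂ _∷ₐ_ (map-replicate head a hashes) (trans (cong tracks (map-replicate tail a hashes)) (tracks-hashes a))

hashTracks-++-padEach : ∀ a m (ws : All Word Ss) → LengthsAtMost m ws →
                        hashTracks a ++ᵗ padEach m ws ≡ padEach (a + m) ws
hashTracks-++-padEach a m []ₐ       _              = refl
hashTracks-++-padEach a m (w ∷ₐ ws) (|w|≤m , fits) = cong₂ _∷ₐ_
  (trans (sym (++-assoc (replicate a nothing) _ _))
    (cong (_++ map just w) (trans (replicate-+ a (m ∸ length w) nothing)
                                  (cong (λ n → replicate n nothing) (sym (+-∸-assoc a |w|≤m))))))
  (hashTracks-++-padEach a m ws fits)

tracks-hashes-++-parallel : ∀ a (ws : All Word Ss) →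
                            tracks (replicate a hashes ++ parallel ws) ≡ padEach (a + maxLen ws) ws
tracks-hashes-++-parallel a ws = begin
    tracks (replicate a hashes ++ parallel ws)        ≡⟨ tracks-++ (replicate a hashes) (parallel ws) ⟩
    tracks (replicate a hashes) ++ᵗ tracks (parallel ws) ≡⟨ cong₂ _++ᵗ_ (tracks-hashes a) (tracks-parallel ws) ⟩
    hashTracks a ++ᵗ padEach (maxLen ws) ws            ≡⟨ hashTracks-++-padEach a (maxLen ws) ws (LengthsAtMost-maxLen ws) ⟩
    padEach (a + maxLen ws) ws                        ∎
  where open ≡-Reasoning

length-hashes-++-parallel : ∀ a (ws : All Word Ss) → length (replicate a (hashes {Ss = Ss}) ++ parallel ws) ≡ a + maxLen ws
length-hashes-++-parallel a ws = trans (length-++ (replicate a hashes)) (cong₂ _+_ (length-replicate a) (length-parallel ws))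

≡hashes-++-parallel : ∀ (u : List (All Sym Ss)) (ws : All Word Ss) → LengthsAtMost (length u) ws →
                      tracks u ≡ padEach (length u) ws → u ≡ replicate (length u ∸ maxLen ws) hashes ++ parallel ws
≡hashes-++-parallel u ws fits tracks≡ =
  tracks-injective u _ (sym (trans (length-hashes-++-parallel a ws) a+maxLen≡))
    (trans tracks≡ (trans (cong (λ n → padEach n ws) (sym a+maxLen≡)) (sym (tracks-hashes-++-parallel a ws))))
  where
  a : ℕ
  a = length u ∸ maxLen ws
  a+maxLen≡ : a + maxLen ws ≡ length u
  a+maxLen≡ = m∸n+n≡m (maxLen-lub (length u) ws fits)

nth-pad≢nothing : ∀ {X : Set} a i (w : List X) → a ≤ i → i < a + length w →
                  nth i (replicate a nothing ++ map just w) ≢ nothing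
nth-pad≢nothing zero    zero    (x ∷ w) _         _         ()
nth-pad≢nothing zero    (suc i) (x ∷ w) _         (s≤s i<)  = nth-pad≢nothing zero i w z≤n i<
nth-pad≢nothing (suc a) (suc i) w       (s≤s a≤i) (s≤s i<)  = nth-pad≢nothing a i w a≤i i<

column-¬AllHash : ∀ m i (ws : All Word Ss) → maxLen ws ≤ m → m ∸ maxLen ws ≤ i → i < m →
                  ¬ AllHash (column m i ws)
column-¬AllHash m i []ₐ       _ past i<m _ = <⇒≱ i<m past
column-¬AllHash m i (w ∷ₐ ws) maxLen≤m past i<m (hash-w , hash-ws) with ≤-total (maxLen ws) (length w)
... | inj₁ ws≤w rewrite m≥n⇒m⊔n≡m ws≤w =
  nth-pad≢nothing (m ∸ length w) i w past (subst (i <_) (sym (m∸n+n≡m maxLen≤m)) i<m) hash-w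
... | inj₂ w≤ws rewrite m≤n⇒m⊔n≡n w≤ws = column-¬AllHash m i ws maxLen≤m past i<m hash-ws

applyUpTo-refine : ∀ {A : Set} {Q : A → Set} n (f : ℕ → A) → (∀ i → i < n → Q (f i)) →
                   Σ (List (Σ A Q)) λ l → map proj₁ l ≡ applyUpTo f n
applyUpTo-refine zero    f _  = [] , refl
applyUpTo-refine (suc n) f Qf with applyUpTo-refine n (f ∘ suc) (λ i i<n → Qf (suc i) (s≤s i<n))
... | l , l≡ = (f 0 , Qf 0 (s≤s z≤n)) ∷ l , cong (f 0 ∷_) l≡

letters : ∀ (ws : All Word Ss) → Σ (List (Letter Ss)) λ w → map proj₁ w ≡ parallel ws
letters ws with applyUpTo-refine {Q = ¬_ ∘ AllHash} (maxLen ws) (λ i → column (maxLen ws) i ws)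
                  (λ i i< → column-¬AllHash (maxLen ws) i ws ≤-refl (≤-trans (≤-reflexive (n∸n≡0 (maxLen ws))) z≤n) i<)
... | l , l≡ = l , trans l≡ (sym (map-upTo _ (maxLen ws)))

RepAll-functional : ∀ (Ss : Vec ANS e) {ns ns′ ws} → RepAll Ss ns ws → RepAll Ss ns′ ws → ns ≡ ns′
RepAll-functional []ᵥ       {[]ᵥ}     {[]ᵥ}      {[]ₐ}     _        _          = refl
RepAll-functional (S ∷ᵥ Ss) {n ∷ᵥ ns} {n′ ∷ᵥ ns′} {w ∷ₐ ws} (r , rs) (r′ , rs′) =
  cong₂ _∷ᵥ_ (trans (sym (proj₂ r)) (proj₂ r′)) (RepAll-functional Ss rs rs′)

RepAll-unique : ∀ (Ss : Vec ANS e) {ns ws ws′} → RepAll Ss ns ws → RepAll Ss ns ws′ → ws ≡ ws′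
RepAll-unique []ᵥ       {[]ᵥ}     {[]ₐ}     {[]ₐ}       _        _          = refl
RepAll-unique (S ∷ᵥ Ss) {n ∷ᵥ ns} {w ∷ₐ ws} {w′ ∷ₐ ws′} (r , rs) (r′ , rs′) =
  cong₂ _∷ₐ_ (Rep-unique S r r′) (RepAll-unique Ss rs rs′)

repAll : ∀ (Ss : Vec ANS e) ns → Σ (All Word Ss) (RepAll Ss ns)
repAll []ᵥ       []ᵥ       = []ₐ , tt
repAll (S ∷ᵥ Ss) (n ∷ᵥ ns) with rep S n | repAll Ss ns
... | w , r | ws , rs = w ∷ₐ ws , r , rs

repV : ∀ (Ss : Vec ANS e) ns → Σ (List (Letter Ss)) (RepV Ss ns)
repV Ss ns with repAll Ss ns
... | ws , rs = proj₁ (letters ws) , ws , rs , proj₂ (letters ws)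

RepV-functional : ∀ (Ss : Vec ANS e) {ns ns′ w} → RepV Ss ns w → RepV Ss ns′ w → ns ≡ ns′
RepV-functional Ss (ws , rs , w≡) (ws′ , rs′ , w≡′) with parallel-injective ws ws′ (trans (sym w≡) w≡′)
... | refl = RepAll-functional Ss rs rs′

++ˡ⁻-++⁺ : ∀ {P : ANS → Set} {Ss₁ : Vec ANS e₁} {Ss₂ : Vec ANS e₂} (a : All P Ss₁) (b : All P Ss₂) →
           ++ˡ⁻ Ss₁ (++⁺ a b) ≡ a
++ˡ⁻-++⁺ []ₐ       b = refl
++ˡ⁻-++⁺ (x ∷ₐ a) b = cong (x ∷ₐ_) (++ˡ⁻-++⁺ a b)

++ʳ⁻-++⁺ : ∀ {P : ANS → Set} {Ss₁ : Vec ANS e₁} {Ss₂ : Vec ANS e₂} (a : All P Ss₁) (b : All P Ss₂) →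
           ++ʳ⁻ Ss₁ (++⁺ a b) ≡ b
++ʳ⁻-++⁺ []ₐ       b = refl
++ʳ⁻-++⁺ (x ∷ₐ a) b = ++ʳ⁻-++⁺ a b

++⁺-++⁻ : ∀ {P : ANS → Set} (Ss₁ : Vec ANS e₁) (c : All P (Ss₁ ++ᵥ Ss₂)) →
          ++⁺ (++ˡ⁻ Ss₁ c) (++ʳ⁻ Ss₁ c) ≡ c
++⁺-++⁻ []ᵥ        c         = refl
++⁺-++⁻ (S ∷ᵥ Ss₁) (x ∷ₐ c) = cong (x ∷ₐ_) (++⁺-++⁻ Ss₁ c)

map-∘-cong : ∀ {A B C : Set} {f : A → C} {g : B → C} {h : A → B} → (∀ x → f x ≡ g (h x)) →
             ∀ xs → map f xs ≡ map g (map h xs)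
map-∘-cong f≗g∘h xs = trans (map-cong f≗g∘h xs) (map-∘ xs)

tracks-split : ∀ (Ss₁ : Vec ANS e₁) (u : List (All Sym (Ss₁ ++ᵥ Ss₂))) →
               tracks u ≡ ++⁺ (tracks (map (++ˡ⁻ Ss₁) u)) (tracks (map (++ʳ⁻ Ss₁) u))
tracks-split []ᵥ        u = cong tracks (sym (map-id u))
tracks-split {Ss₂ = Ss₂} (S ∷ᵥ Ss₁) u = cong₂ _∷ₐ_ (map-∘-cong head-left u)
  (trans (tracks-split Ss₁ (map tail u)) (cong₂ ++⁺
    (cong tracks (trans (sym (map-∘ u)) (map-∘-cong left-tail u)))
    (cong tracks (trans (sym (map-∘ u)) (map-cong right-tail u)))))
  where
  head-left : ∀ (c : All Sym ((S ∷ᵥ Ss₁) ++ᵥ Ss₂)) → head c ≡ head (++ˡ⁻ (S ∷ᵥ Ss₁) c)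
  head-left (x ∷ₐ c) = refl
  left-tail : ∀ (c : All Sym ((S ∷ᵥ Ss₁) ++ᵥ Ss₂)) → ++ˡ⁻ Ss₁ (tail c) ≡ tail (++ˡ⁻ (S ∷ᵥ Ss₁) c)
  left-tail (x ∷ₐ c) = refl
  right-tail : ∀ (c : All Sym ((S ∷ᵥ Ss₁) ++ᵥ Ss₂)) → ++ʳ⁻ Ss₁ (tail c) ≡ ++ʳ⁻ (S ∷ᵥ Ss₁) c
  right-tail (x ∷ₐ c) = refl

padEach-++⁺ : ∀ m (ws : All Word Ss₁) (ws′ : All Word Ss₂) →
              padEach m (++⁺ ws ws′) ≡ ++⁺ (padEach m ws) (padEach m ws′)
padEach-++⁺ m []ₐ       ws′ = refl
padEach-++⁺ m (w ∷ₐ ws) ws′ = cong (pad m w ∷ₐ_) (padEach-++⁺ m ws ws′)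

maxLen-++⁺ : ∀ (ws : All Word Ss₁) (ws′ : All Word Ss₂) → maxLen (++⁺ ws ws′) ≡ maxLen ws ⊔ maxLen ws′
maxLen-++⁺ []ₐ       ws′ = refl
maxLen-++⁺ (w ∷ₐ ws) ws′ = trans (cong (length w ⊔_) (maxLen-++⁺ ws ws′)) (sym (⊔-assoc (length w) _ _))

RepAll-++⁺ : ∀ {ns ns′} (ws : All Word Ss₁) (ws′ : All Word Ss₂) → RepAll Ss₁ ns ws → RepAll Ss₂ ns′ ws′ →
             RepAll (Ss₁ ++ᵥ Ss₂) (ns ++ᵥ ns′) (++⁺ ws ws′)
RepAll-++⁺ {ns = []ᵥ}     []ₐ       ws′ _        rs′ = rs′
RepAll-++⁺ {ns = n ∷ᵥ ns} (w ∷ₐ ws) ws′ (r , rs) rs′ = r , RepAll-++⁺ ws ws′ rs rs′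

RepAll-++⁻ : ∀ {ns ns′} (ws : All Word Ss₁) (ws′ : All Word Ss₂) →
             RepAll (Ss₁ ++ᵥ Ss₂) (ns ++ᵥ ns′) (++⁺ ws ws′) → RepAll Ss₁ ns ws × RepAll Ss₂ ns′ ws′
RepAll-++⁻ {ns = []ᵥ}     []ₐ       ws′ rs′      = tt , rs′
RepAll-++⁻ {ns = n ∷ᵥ ns} (w ∷ₐ ws) ws′ (r , rs) with RepAll-++⁻ ws ws′ rs
... | rs₁ , rs₂ = (r , rs₁) , rs₂

AllHash-++⁻ : ∀ (a : All Sym Ss₁) (b : All Sym Ss₂) → AllHash (++⁺ a b) → AllHash a × AllHash b
AllHash-++⁻ []ₐ       b hash-b              = tt , hash-b
AllHash-++⁻ (x ∷ₐ a) b (hash-x , hash-ab) = map₁ (hash-x ,_) (AllHash-++⁻ a b hash-ab)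

AllHash-++⁺ : ∀ (a : All Sym Ss₁) (b : All Sym Ss₂) → AllHash a → AllHash b → AllHash (++⁺ a b)
AllHash-++⁺ []ₐ       b _                hash-b = hash-b
AllHash-++⁺ (x ∷ₐ a) b (hash-x , hash-a) hash-b = hash-x , AllHash-++⁺ a b hash-a hash-b

infixr 5 _⊕_

_⊕_ : Letter Ss₁ → Letter Ss₂ → Letter (Ss₁ ++ᵥ Ss₂)
(a , ¬hash-a) ⊕ (b , _) = ++⁺ a b , ¬hash-a ∘ proj₁ ∘ AllHash-++⁻ a b

_⊕# : Letter Ss₁ → Letter (Ss₁ ++ᵥ Ss₂)
(a , ¬hash-a) ⊕# = ++⁺ a hashes , ¬hash-a ∘ proj₁ ∘ AllHash-++⁻ a hashes

#⊕_ : Letter Ss₂ → Letter (Ss₁ ++ᵥ Ss₂)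
#⊕ (b , ¬hash-b) = ++⁺ hashes b , ¬hash-b ∘ proj₂ ∘ AllHash-++⁻ hashes b

alignEnd : List (Letter Ss₁) → List (Letter Ss₂) → List (Letter (Ss₁ ++ᵥ Ss₂))
alignEnd []       []       = []
alignEnd (x ∷ xs) []       = (x ⊕#) ∷ alignEnd xs []
alignEnd []       (y ∷ ys) = (#⊕ y) ∷ alignEnd [] ys
alignEnd (x ∷ xs) (y ∷ ys) = (x ⊕ y) ∷ alignEnd xs ys

-- Two words read in parallel, the shorter one left-padded with #.
align : List (Letter Ss₁) → List (Letter Ss₂) → List (Letter (Ss₁ ++ᵥ Ss₂))
align w r = reverse (alignEnd (reverse w) (reverse r))

length-alignEnd : ∀ (xs : List (Letter Ss₁)) (ys : List (Letter Ss₂)) →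
                  length (alignEnd xs ys) ≡ length xs ⊔ length ys
length-alignEnd []       []       = refl
length-alignEnd (x ∷ xs) []       = cong suc (trans (length-alignEnd xs []) (⊔-identityʳ (length xs)))
length-alignEnd []       (y ∷ ys) = cong suc (length-alignEnd [] ys)
length-alignEnd (x ∷ xs) (y ∷ ys) = cong suc (length-alignEnd xs ys)

length-align : ∀ (w : List (Letter Ss₁)) (r : List (Letter Ss₂)) → length (align w r) ≡ length w ⊔ length r
length-align w r = trans (length-reverse (alignEnd (reverse w) (reverse r)))
  (trans (length-alignEnd (reverse w) (reverse r)) (cong₂ _⊔_ (length-reverse w) (length-reverse r)))

left-alignEnd : ∀ {Ss₁ : Vec ANS e₁} (xs : List (Letter Ss₁)) (ys : List (Letter Ss₂)) →
  map (++ˡ⁻ Ss₁ ∘ proj₁) (alignEnd xs ys) ≡ map proj₁ xs ++ replicate (length ys ∸ length xs) hashes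
left-alignEnd []             []             = refl
left-alignEnd ((a , _) ∷ xs) []             = cong₂ _∷_ (++ˡ⁻-++⁺ a hashes)
  (trans (left-alignEnd xs []) (cong (λ n → map proj₁ xs ++ replicate n hashes) (0∸n≡0 (length xs))))
left-alignEnd []             ((b , _) ∷ ys) = cong₂ _∷_ (++ˡ⁻-++⁺ hashes b) (left-alignEnd [] ys)
left-alignEnd ((a , _) ∷ xs) ((b , _) ∷ ys) = cong₂ _∷_ (++ˡ⁻-++⁺ a b) (left-alignEnd xs ys)

right-alignEnd : ∀ (xs : List (Letter Ss₁)) (ys : List (Letter Ss₂)) →
  map (++ʳ⁻ Ss₁ ∘ proj₁) (alignEnd xs ys) ≡ map proj₁ ys ++ replicate (length xs ∸ length ys) hashes
right-alignEnd []             []             = refl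
right-alignEnd ((a , _) ∷ xs) []             = cong₂ _∷_ (++ʳ⁻-++⁺ a hashes) (right-alignEnd xs [])
right-alignEnd {Ss₁ = Ss₁} []             ((b , _) ∷ ys) = cong₂ _∷_ (++ʳ⁻-++⁺ (hashes {Ss = Ss₁}) b)
  (trans (right-alignEnd [] ys) (cong (λ n → map proj₁ ys ++ replicate n hashes) (0∸n≡0 (length ys))))
right-alignEnd ((a , _) ∷ xs) ((b , _) ∷ ys) = cong₂ _∷_ (++ʳ⁻-++⁺ a b) (right-alignEnd xs ys)

reverse-replicate : ∀ {X : Set} a (x : X) → reverse (replicate a x) ≡ replicate a x
reverse-replicate zero    x = refl
reverse-replicate (suc a) x = begin
    reverse (x ∷ replicate a x)   ≡⟨ unfold-reverse x (replicate a x) ⟩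
    reverse (replicate a x) ∷ʳ x  ≡⟨ cong (_∷ʳ x) (reverse-replicate a x) ⟩
    replicate a x ++ replicate 1 x ≡⟨ replicate-+ a 1 x ⟩
    replicate (a + 1) x           ≡⟨ cong (λ n → replicate n x) (+-comm a 1) ⟩
    replicate (suc a) x           ∎
  where open ≡-Reasoning

reverse-map-reverse-++-replicate : ∀ {A B : Set} (f : A → B) (xs : List A) a b →
  reverse (map f (reverse xs) ++ replicate a b) ≡ replicate a b ++ map f xs
reverse-map-reverse-++-replicate f xs a b = trans (reverse-++ (map f (reverse xs)) (replicate a b))
  (cong₂ _++_ (reverse-replicate a b) (trans (cong reverse (reverse-map f xs)) (reverse-involutive (map f xs))))

left-align : ∀ {Ss₁ : Vec ANS e₁} (w : List (Letter Ss₁)) (r : List (Letter Ss₂)) →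
  map (++ˡ⁻ Ss₁ ∘ proj₁) (align w r) ≡ replicate (length r ∸ length w) hashes ++ map proj₁ w
left-align {Ss₁ = Ss₁} w r = begin
    map (++ˡ⁻ Ss₁ ∘ proj₁) (reverse (alignEnd (reverse w) (reverse r)))
  ≡⟨ reverse-map (++ˡ⁻ Ss₁ ∘ proj₁) (alignEnd (reverse w) (reverse r)) ⟩
    reverse (map (++ˡ⁻ Ss₁ ∘ proj₁) (alignEnd (reverse w) (reverse r)))
  ≡⟨ cong reverse (left-alignEnd (reverse w) (reverse r)) ⟩
    reverse (map proj₁ (reverse w) ++ replicate (length (reverse r) ∸ length (reverse w)) hashes)
  ≡⟨ cong (λ n → reverse (map proj₁ (reverse w) ++ replicate n hashes))
          (cong₂ _∸_ (length-reverse r) (length-reverse w)) ⟩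
    reverse (map proj₁ (reverse w) ++ replicate (length r ∸ length w) hashes)
  ≡⟨ reverse-map-reverse-++-replicate proj₁ w _ hashes ⟩
    replicate (length r ∸ length w) hashes ++ map proj₁ w
  ∎
  where open ≡-Reasoning

right-align : ∀ (w : List (Letter Ss₁)) (r : List (Letter Ss₂)) →
  map (++ʳ⁻ Ss₁ ∘ proj₁) (align w r) ≡ replicate (length w ∸ length r) hashes ++ map proj₁ r
right-align {Ss₁ = Ss₁} w r = begin
    map (++ʳ⁻ Ss₁ ∘ proj₁) (reverse (alignEnd (reverse w) (reverse r)))
  ≡⟨ reverse-map (++ʳ⁻ Ss₁ ∘ proj₁) (alignEnd (reverse w) (reverse r)) ⟩
    reverse (map (++ʳ⁻ Ss₁ ∘ proj₁) (alignEnd (reverse w) (reverse r)))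
  ≡⟨ cong reverse (right-alignEnd (reverse w) (reverse r)) ⟩
    reverse (map proj₁ (reverse r) ++ replicate (length (reverse w) ∸ length (reverse r)) hashes)
  ≡⟨ cong (λ n → reverse (map proj₁ (reverse r) ++ replicate n hashes))
          (cong₂ _∸_ (length-reverse w) (length-reverse r)) ⟩
    reverse (map proj₁ (reverse r) ++ replicate (length w ∸ length r) hashes)
  ≡⟨ reverse-map-reverse-++-replicate proj₁ r _ hashes ⟩
    replicate (length w ∸ length r) hashes ++ map proj₁ r
  ∎
  where open ≡-Reasoning

align-∷ʳ : ∀ (p : List (Letter Ss₁)) (q : List (Letter Ss₂)) x y → align (p ∷ʳ x) (q ∷ʳ y) ≡ align p q ∷ʳ (x ⊕ y)
align-∷ʳ p q x y = trans (cong₂ (λ a b → reverse (alignEnd a b)) (reverse-++ p [ x ]) (reverse-++ q [ y ]))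
  (unfold-reverse (x ⊕ y) (alignEnd (reverse p) (reverse q)))

align-∷ʳ-[] : ∀ {Ss₁ : Vec ANS e₁} (p : List (Letter Ss₁)) x →
              align {Ss₂ = Ss₂} (p ∷ʳ x) [] ≡ align p [] ∷ʳ (x ⊕#)
align-∷ʳ-[] p x = trans (cong (λ a → reverse (alignEnd a [])) (reverse-++ p [ x ]))
  (unfold-reverse (x ⊕#) (alignEnd (reverse p) []))

∸+≡⊔ : ∀ m n → n ∸ m + m ≡ m ⊔ n
∸+≡⊔ m n with ≤-total m n
... | inj₁ m≤n = trans (m∸n+n≡m m≤n) (sym (m≤n⇒m⊔n≡n m≤n))
... | inj₂ n≤m = trans (cong (_+ m) (m≤n⇒m∸n≡0 n≤m)) (sym (m≥n⇒m⊔n≡m n≤m))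

length-letters : ∀ {w : List (Letter Ss)} {ws} → map proj₁ w ≡ parallel ws → length w ≡ maxLen ws
length-letters {w = w} {ws} w≡ = trans (sym (length-map proj₁ w)) (trans (cong length w≡) (length-parallel ws))

tracks-hashes-++-letters : ∀ a {w : List (Letter Ss)} {ws} → map proj₁ w ≡ parallel ws →
                           tracks (replicate a hashes ++ map proj₁ w) ≡ padEach (a + length w) ws
tracks-hashes-++-letters a {w} {ws} w≡ = begin
    tracks (replicate a hashes ++ map proj₁ w) ≡⟨ cong (λ u → tracks (replicate a hashes ++ u)) w≡ ⟩
    tracks (replicate a hashes ++ parallel ws) ≡⟨ tracks-hashes-++-parallel a ws ⟩
    padEach (a + maxLen ws) ws                ≡⟨ cong (λ n → padEach (a + n) ws) (sym (length-letters w≡)) ⟩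
    padEach (a + length w) ws                 ∎
  where open ≡-Reasoning

RepV-align : ∀ {Ss₁ : Vec ANS e₁} {ns ns′ w r} → RepV Ss₁ ns w → RepV Ss₂ ns′ r →
             RepV (Ss₁ ++ᵥ Ss₂) (ns ++ᵥ ns′) (align w r)
RepV-align {Ss₂ = Ss₂} {Ss₁ = Ss₁} {w = w} {r} (ws , rs , w≡) (ws′ , rs′ , r≡) =
  ++⁺ ws ws′ , RepAll-++⁺ ws ws′ rs rs′ , ≡parallel U (++⁺ ws ws′) |U|≡maxLen tracks≡
  where
  open ≡-Reasoning
  U : List (All Sym (Ss₁ ++ᵥ Ss₂))
  U = map proj₁ (align w r)
  |U|≡ : length U ≡ length w ⊔ length r
  |U|≡ = trans (length-map proj₁ (align w r)) (length-align w r)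
  |U|≡maxLen : length U ≡ maxLen (++⁺ ws ws′)
  |U|≡maxLen = trans |U|≡ (trans (cong₂ _⊔_ (length-letters w≡) (length-letters r≡)) (sym (maxLen-++⁺ ws ws′)))
  left : tracks (map (++ˡ⁻ Ss₁) U) ≡ padEach (length U) ws
  left = begin
      tracks (map (++ˡ⁻ Ss₁) U)                                 ≡⟨ cong tracks (sym (map-∘ (align w r))) ⟩
      tracks (map (++ˡ⁻ Ss₁ ∘ proj₁) (align w r))               ≡⟨ cong tracks (left-align w r) ⟩
      tracks (replicate (length r ∸ length w) hashes ++ map proj₁ w) ≡⟨ tracks-hashes-++-letters _ w≡ ⟩
      padEach (length r ∸ length w + length w) ws               ≡⟨ cong (λ n → padEach n ws)
                                                                     (trans (∸+≡⊔ (length w) (length r)) (sym |U|≡)) ⟩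
      padEach (length U) ws                                     ∎
  right : tracks (map (++ʳ⁻ Ss₁) U) ≡ padEach (length U) ws′
  right = begin
      tracks (map (++ʳ⁻ Ss₁) U)                                 ≡⟨ cong tracks (sym (map-∘ (align w r))) ⟩
      tracks (map (++ʳ⁻ Ss₁ ∘ proj₁) (align w r))               ≡⟨ cong tracks (right-align w r) ⟩
      tracks (replicate (length w ∸ length r) hashes ++ map proj₁ r) ≡⟨ tracks-hashes-++-letters _ r≡ ⟩
      padEach (length w ∸ length r + length r) ws′              ≡⟨ cong (λ n → padEach n ws′)
                                                                     (trans (∸+≡⊔ (length r) (length w))
                                                                     (trans (⊔-comm (length r) (length w)) (sym |U|≡))) ⟩
      padEach (length U) ws′                                    ∎
  tracks≡ : tracks U ≡ padEach (length U) (++⁺ ws ws′)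
  tracks≡ = trans (tracks-split Ss₁ U) (trans (cong₂ ++⁺ left right) (sym (padEach-++⁺ (length U) ws ws′)))

record Finite (Q : Set) : Set where
  field
    size          : ℕ
    encode        : Q → Fin size
    decode        : Fin size → Q
    decode-encode : ∀ q → decode (encode q) ≡ q

open Finite

finite-Fin : ∀ n → Finite (Fin n)
finite-Fin n = record { size = n ; encode = id ; decode = id ; decode-encode = λ _ → refl }

finite-⊤ : Finite ⊤
finite-⊤ = record { size = 1 ; encode = λ _ → fzero ; decode = λ _ → tt ; decode-encode = λ _ → refl }

finite-Maybe : ∀ {Q} → Finite Q → Finite (Maybe Q)
finite-Maybe {Q} F = record { size = suc (size F) ; encode = enc ; decode = dec ; decode-encode = dec-enc }
  where
  enc : Maybe Q → Fin (suc (size F))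
  enc nothing  = fzero
  enc (just q) = fsuc (encode F q)
  dec : Fin (suc (size F)) → Maybe Q
  dec fzero    = nothing
  dec (fsuc i) = just (decode F i)
  dec-enc : ∀ q → dec (enc q) ≡ q
  dec-enc nothing  = refl
  dec-enc (just q) = cong just (decode-encode F q)

finite-× : ∀ {Q R} → Finite Q → Finite R → Finite (Q × R)
finite-× {Q} {R} F G = record { size = size F * size G ; encode = enc ; decode = dec ; decode-encode = dec-enc }
  where
  enc : Q × R → Fin (size F * size G)
  enc (q , r) = combine (encode F q) (encode G r)
  dec : Fin (size F * size G) → Q × R
  dec i = decode F (proj₁ (remQuot {size F} (size G) i)) , decode G (proj₂ (remQuot {size F} (size G) i))
  dec-enc : ∀ q → dec (enc q) ≡ q
  dec-enc (q , r) = cong₂ _,_ (trans (cong (decode F ∘ proj₁) split) (decode-encode F q))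
                              (trans (cong (decode G ∘ proj₂) split) (decode-encode G r))
    where
    split : remQuot (size G) (combine (encode F q) (encode G r)) ≡ (encode F q , encode G r)
    split = remQuot-combine (encode F q) (encode G r)

finite-retract : ∀ {Q R} → Finite R → (f : Q → R) (g : R → Q) → (∀ q → g (f q) ≡ q) → Finite Q
finite-retract F f g g∘f = record { size = size F ; encode = encode F ∘ f ; decode = g ∘ decode F
                                  ; decode-encode = λ q → trans (cong g (decode-encode F (f q))) (g∘f q) }

finite-Bool : Finite Bool
finite-Bool = finite-retract (finite-Maybe finite-⊤) (λ b → if b then just tt else nothing)
  (λ { (just _) → true ; nothing → false }) (λ { true → refl ; false → refl })

finite-Vec : ∀ {Q} → Finite Q → ∀ n → Finite (Vec Q n)
finite-Vec F zero    = finite-retract finite-⊤ (λ _ → tt) (λ _ → []ᵥ) (λ { []ᵥ → refl })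
finite-Vec F (suc n) = finite-retract (finite-× F (finite-Vec F n))
  (λ { (x ∷ᵥ xs) → x , xs }) (λ { (x , xs) → x ∷ᵥ xs }) (λ { (x ∷ᵥ xs) → refl })

finite-All : ∀ {P : ANS → Set} → (∀ S → Finite (P S)) → ∀ (Ss : Vec ANS e) → Finite (All P Ss)
finite-All F []ᵥ       = finite-retract finite-⊤ (λ _ → tt) (λ _ → []ₐ) (λ { []ₐ → refl })
finite-All F (S ∷ᵥ Ss) = finite-retract (finite-× (F S) (finite-All F Ss))
  (λ { (x ∷ₐ xs) → x , xs }) (λ { (x , xs) → x ∷ₐ xs }) (λ { (x ∷ₐ xs) → refl })

finite-Allᴸ : ∀ {X : Set} {P : X → Set} → (∀ x → Finite (P x)) → (xs : List X) → Finite (Allᴸ P xs)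
finite-Allᴸ F []       = finite-retract finite-⊤ (λ _ → tt) (λ _ → Allᴸ.[]) (λ { Allᴸ.[] → refl })
finite-Allᴸ F (x ∷ xs) = finite-retract (finite-× (F x) (finite-Allᴸ F xs))
  (λ { (p Allᴸ.∷ ps) → p , ps }) (λ { (p , ps) → p Allᴸ.∷ ps }) (λ { (p Allᴸ.∷ ps) → refl })

runFrom≡foldl : ∀ {A : Set} (M : DFA A) q w → runFrom M q w ≡ foldl (DFA.δ M) q w
runFrom≡foldl M q []      = refl
runFrom≡foldl M q (a ∷ w) = runFrom≡foldl M (DFA.δ M q a) w

toDFA : ∀ {Q A : Set} → Finite Q → Q → (Q → A → Q) → DFA A
toDFA F q₀ δ = record { nQ = size F ; q₀ = encode F q₀ ; δ = λ i a → encode F (δ (decode F i) a) }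

decode-runFrom-toDFA : ∀ {Q A : Set} (F : Finite Q) q₀ (δ : Q → A → Q) q w →
                       decode F (runFrom (toDFA F q₀ δ) (encode F q) w) ≡ foldl δ q w
decode-runFrom-toDFA F q₀ δ q []      = decode-encode F q
decode-runFrom-toDFA F q₀ δ q (a ∷ w) rewrite decode-encode F q = decode-runFrom-toDFA F q₀ δ (δ q a) w

decode-run-toDFA : ∀ {Q A : Set} (F : Finite Q) q₀ (δ : Q → A → Q) w →
                   decode F (run (toDFA F q₀ δ) w) ≡ foldl δ q₀ w
decode-run-toDFA F q₀ δ = decode-runFrom-toDFA F q₀ δ q₀

-- Synchronized sequences with finite range are automatic

lastᵥ : ∀ {Q : Set} {n} → Vec Q (suc n) → Q
lastᵥ (x ∷ᵥ []ᵥ)       = x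
lastᵥ (x ∷ᵥ y ∷ᵥ ys) = lastᵥ (y ∷ᵥ ys)

run-∷ʳ : ∀ {A : Set} (M : DFA A) w a → run M (w ∷ʳ a) ≡ DFA.δ M (run M w) a
run-∷ʳ M w a = trans (runFrom≡foldl M (DFA.q₀ M) (w ∷ʳ a))
  (trans (foldl-∷ʳ (DFA.δ M) (DFA.q₀ M) a w) (cong (λ q → DFA.δ M q a) (sym (runFrom≡foldl M (DFA.q₀ M) w))))

module GraphRuns {d d′} {Ss : Vec ANS d} {Ss′ : Vec ANS d′} (M : DFA (Letter (Ss ++ᵥ Ss′))) where

  Q : Set
  Q = Fin (DFA.nQ M)

  δ : Q → Letter (Ss ++ᵥ Ss′) → Q
  δ = DFA.δ M

  -- runs p pre rs lists the states of M after reading align p (pre ++ take i rs), for i = 0 … length rs.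
  mutual
    runs : List (Letter Ss) → List (Letter Ss′) → (rs : List (Letter Ss′)) → Vec Q (suc (length rs))
    runs p pre rs = run M (align p pre) ∷ᵥ laterRuns p pre rs

    laterRuns : List (Letter Ss) → List (Letter Ss′) → (rs : List (Letter Ss′)) → Vec Q (length rs)
    laterRuns p pre []       = []ᵥ
    laterRuns p pre (r ∷ rs) = runs p (pre ∷ʳ r) rs

  advance : Letter Ss → Q → (rs : List (Letter Ss′)) → Vec Q (length rs) → Vec Q (length rs)
  advance x prev []       []ᵥ       = []ᵥ
  advance x prev (r ∷ rs) (h ∷ᵥ hs) = δ prev (x ⊕ r) ∷ᵥ advance x h rs hs

  step : (rs : List (Letter Ss′)) → Vec Q (suc (length rs)) → Letter Ss → Vec Q (suc (length rs))
  step rs (h ∷ᵥ hs) x = δ h (x ⊕#) ∷ᵥ advance x h rs hs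

  advance-laterRuns : ∀ p pre rs x → advance x (run M (align p pre)) rs (laterRuns p pre rs) ≡ laterRuns (p ∷ʳ x) pre rs
  advance-laterRuns p pre []       x = refl
  advance-laterRuns p pre (r ∷ rs) x = cong₂ _∷ᵥ_
    (trans (sym (run-∷ʳ M (align p pre) (x ⊕ r))) (cong (run M) (sym (align-∷ʳ p pre x r))))
    (advance-laterRuns p (pre ∷ʳ r) rs x)

  step-runs : ∀ p rs x → step rs (runs p [] rs) x ≡ runs (p ∷ʳ x) [] rs
  step-runs p rs x = cong₂ _∷ᵥ_
    (trans (sym (run-∷ʳ M (align p []) (x ⊕#))) (cong (run M) (sym (align-∷ʳ-[] p x))))
    (advance-laterRuns p [] rs x)

  lastᵥ-runs : ∀ p pre rs → lastᵥ (runs p pre rs) ≡ run M (align p (pre ++ rs))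
  lastᵥ-runs p pre []       = cong (run M ∘ align p) (sym (++-identityʳ pre))
  lastᵥ-runs p pre (r ∷ rs) = trans (lastᵥ-runs p (pre ∷ʳ r) rs) (cong (run M ∘ align p) (++-assoc pre [ r ] rs))

  module _ (code : Vec ℕ d′ → List (Letter Ss′)) where

    States : List (Vec ℕ d′) → Set
    States = Allᴸ (λ v → Vec Q (suc (length (code v))))

    allRuns : List (Letter Ss) → ∀ vs → States vs
    allRuns p = Allᴸ.universal (λ v → runs p [] (code v))

    stepAll : ∀ {vs} → States vs → Letter Ss → States vs
    stepAll hs x = Allᴸ.map (λ {v} h → step (code v) h x) hs

    stepAll-allRuns : ∀ p vs x → stepAll (allRuns p vs) x ≡ allRuns (p ∷ʳ x) vs
    stepAll-allRuns p []       x = refl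
    stepAll-allRuns p (v ∷ vs) x = cong₂ Allᴸ._∷_ (step-runs p (code v) x) (stepAll-allRuns p vs x)

    foldl-stepAll : ∀ p vs w → foldl stepAll (allRuns p vs) w ≡ allRuns (p ++ w) vs
    foldl-stepAll p vs []      = cong (λ p → allRuns p vs) (sym (++-identityʳ p))
    foldl-stepAll p vs (x ∷ w) = trans (cong (λ hs → foldl stepAll hs w) (stepAll-allRuns p vs x))
      (trans (foldl-stepAll (p ∷ʳ x) vs w) (cong (λ p → allRuns p vs) (++-assoc p [ x ] w)))

    finite-States : ∀ vs → Finite (States vs)
    finite-States = finite-Allᴸ (λ v → finite-Vec (finite-Fin (DFA.nQ M)) (suc (length (code v))))

    -- The fallback value is irrelevant: on rep(n) the candidate f(n) ∈ vs is accepted.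
    output : (Fin (DFA.nQ M) → Bool) → ∀ vs → States vs → Vec ℕ d′
    output F []       Allᴸ.[]         = replicateᵥ d′ 0
    output F (v ∷ vs) (h Allᴸ.∷ hs) = if F (lastᵥ h) then v else output F vs hs

GraphWord : ∀ {d d′} (Ss : Vec ANS d) (Ss′ : Vec ANS d′) → (Vec ℕ d → Vec ℕ d′) →
            List (Letter (Ss ++ᵥ Ss′)) → Set
GraphWord {d} {d′} Ss Ss′ f c = Σ (Vec ℕ (d + d′)) λ x → Graph f x × RepV (Ss ++ᵥ Ss′) x c

graph-align : ∀ {d d′} {Ss : Vec ANS d} {Ss′ : Vec ANS d′} (f : Vec ℕ d → Vec ℕ d′) {ns v w r} →
              RepV Ss ns w → RepV Ss′ v r → GraphWord Ss Ss′ f (align w r) ⇔ f ns ≡ v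
graph-align {Ss = Ss} {Ss′} f {ns} {v} {w} {r} w-rep r-rep = mk⇔ ⇒ ⇐
  where
  aligned : RepV (Ss ++ᵥ Ss′) (ns ++ᵥ v) (align w r)
  aligned = RepV-align w-rep r-rep
  ⇒ : GraphWord Ss Ss′ f (align w r) → f ns ≡ v
  ⇒ (x , (ns′ , x≡) , x-rep) = trans (cong f (sym (++-injectiveˡ ns′ ns same))) (++-injectiveʳ ns′ ns same)
    where
    same : ns′ ++ᵥ f ns′ ≡ ns ++ᵥ v
    same = trans (sym x≡) (RepV-functional (Ss ++ᵥ Ss′) x-rep aligned)
  ⇐ : f ns ≡ v → GraphWord Ss Ss′ f (align w r)
  ⇐ fns≡v = ns ++ᵥ v , (ns , cong (ns ++ᵥ_) (sym fns≡v)) , aligned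

synchronized⇒automatic : ∀ {d d′} (Ss : Vec ANS d) (Ss′ : Vec ANS d′) (f : Vec ℕ d → Vec ℕ d′) →
                         Synchronized Ss Ss′ f → FiniteRange f → Automatic Ss f
synchronized⇒automatic {d′ = d′} Ss Ss′ f (M , F , recognizes) (vs , f∈vs) = M′ , τ , correct
  where
  open GraphRuns {Ss = Ss} {Ss′} M
  code : Vec ℕ d′ → List (Letter Ss′)
  code v = proj₁ (repV Ss′ v)
  M′ : DFA (Letter Ss)
  M′ = toDFA (finite-States code vs) (allRuns code [] vs) (stepAll code)
  τ : Fin (DFA.nQ M′) → Vec ℕ _
  τ i = output code F vs (decode (finite-States code vs) i)
  correct : ∀ ns w → RepV Ss ns w → f ns ≡ τ (run M′ w)
  correct ns w w-rep = sym (begin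
      output code F vs (decode (finite-States code vs) (run M′ w))
    ≡⟨ cong (output code F vs) (trans (decode-run-toDFA (finite-States code vs) _ _ w) (foldl-stepAll code [] vs w)) ⟩
      output code F vs (allRuns code w vs)
    ≡⟨ output-allRuns vs (f∈vs ns) ⟩
      f ns ∎)
    where
    open ≡-Reasoning
    accepts⇔ : ∀ v → T (F (run M (align w (code v)))) ⇔ f ns ≡ v
    accepts⇔ v with recognizes (align w (code v)) | graph-align f w-rep (proj₂ (repV Ss′ v))
    ... | recognized | graph = mk⇔ (to graph ∘ from recognized) (to recognized ∘ from graph)
    output-allRuns : ∀ vs → f ns ∈ vs → output code F vs (allRuns code w vs) ≡ f ns
    output-allRuns (v ∷ vs) fns∈ with F (lastᵥ (runs w [] (code v))) in accept
    ... | true = sym (to (accepts⇔ v) (subst T (trans (sym accept) (cong F (lastᵥ-runs w [] (code v)))) tt))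
    ... | false with fns∈
    ... | there fns∈vs = output-allRuns vs fns∈vs
    ... | here refl = ⊥-elim (subst T (trans (cong F (sym (lastᵥ-runs w [] (code v)))) accept) (from (accepts⇔ v) refl))

-- Automatic sequences are synchronized

-- Reading one track: nothing is the dead state, just nothing the state before the first letter.
module TrackAutomaton (S : ANS) where

  private
    aut : DFA (Fin (ANS.k S))
    aut = ANS.aut S
    δ : Fin (DFA.nQ aut) → Fin (ANS.k S) → Fin (DFA.nQ aut)
    δ = DFA.δ aut
    q₀ : Fin (DFA.nQ aut)
    q₀ = DFA.q₀ aut

  TrackState : Set
  TrackState = Maybe (Maybe (Fin (DFA.nQ aut)))

  finite-TrackState : Finite TrackState
  finite-TrackState = finite-Maybe (finite-Maybe (finite-Fin _))

  leading : TrackState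
  leading = just nothing

  trackStep : TrackState → Sym S → TrackState
  trackStep nothing         _        = nothing
  trackStep (just nothing)  nothing  = just nothing
  trackStep (just nothing)  (just a) = just (just (δ q₀ a))
  trackStep (just (just q)) nothing  = nothing
  trackStep (just (just q)) (just a) = just (just (δ q a))

  trackAccept : TrackState → Bool
  trackAccept nothing         = false
  trackAccept (just nothing)  = ANS.final S q₀
  trackAccept (just (just q)) = ANS.final S q

  foldl-dead : ∀ xs → foldl trackStep nothing xs ≡ nothing
  foldl-dead []       = refl
  foldl-dead (x ∷ xs) = foldl-dead xs

  foldl-reading : ∀ q w → foldl trackStep (just (just q)) (map just w) ≡ just (just (runFrom aut q w))
  foldl-reading q []      = refl
  foldl-reading q (b ∷ w) = foldl-reading (δ q b) w

  foldl-leading : ∀ a xs → foldl trackStep leading (replicate a nothing ++ xs) ≡ foldl trackStep leading xs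
  foldl-leading zero    xs = refl
  foldl-leading (suc a) xs = foldl-leading a xs

  trackAccept-pad : ∀ a w → trackAccept (foldl trackStep leading (replicate a nothing ++ map just w)) ≡ inL S w
  trackAccept-pad a w = trans (cong trackAccept (foldl-leading a (map just w))) (accept-word w)
    where
    accept-word : ∀ w → trackAccept (foldl trackStep leading (map just w)) ≡ inL S w
    accept-word []      = refl
    accept-word (b ∷ w) = cong trackAccept (foldl-reading (δ q₀ b) w)

  accepted-reading : ∀ q xs → T (trackAccept (foldl trackStep (just (just q)) xs)) →
                     Σ (Word S) λ w → xs ≡ map just w
  accepted-reading q []             _   = [] , refl
  accepted-reading q (nothing ∷ xs) acc rewrite foldl-dead xs = ⊥-elim acc
  accepted-reading q (just b ∷ xs)  acc with accepted-reading (δ q b) xs acc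
  ... | w , xs≡ = b ∷ w , cong (just b ∷_) xs≡

  accepted-leading : ∀ xs → T (trackAccept (foldl trackStep leading xs)) →
                     Σ ℕ λ a → Σ (Word S) λ w → xs ≡ replicate a nothing ++ map just w
  accepted-leading []             _   = 0 , [] , refl
  accepted-leading (nothing ∷ xs) acc with accepted-leading xs acc
  ... | a , w , xs≡ = suc a , w , cong (nothing ∷_) xs≡
  accepted-leading (just b ∷ xs)  acc with accepted-reading (δ q₀ b) xs acc
  ... | w , xs≡ = 0 , b ∷ w , cong (just b ∷_) xs≡

open TrackAutomaton using (TrackState; finite-TrackState; leading; trackStep; trackAccept)

AllInL : All Word Ss → Set
AllInL []ₐ                       = ⊤
AllInL {Ss = S ∷ᵥ Ss} (w ∷ₐ ws) = T (inL S w) × AllInL ws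

ValidState : Vec ANS e → Set
ValidState = All TrackState

validStart : ValidState Ss
validStart {Ss = []ᵥ}     = []ₐ
validStart {Ss = S ∷ᵥ Ss} = leading S ∷ₐ validStart

validStep : ValidState Ss → All Sym Ss → ValidState Ss
validStep []ₐ                          []ₐ       = []ₐ
validStep {Ss = S ∷ᵥ Ss} (s ∷ₐ ss) (x ∷ₐ xs) = trackStep S s x ∷ₐ validStep ss xs

validAccept : ValidState Ss → Bool
validAccept []ₐ                       = true
validAccept {Ss = S ∷ᵥ Ss} (s ∷ₐ ss) = trackAccept S s ∧ validAccept ss

foldl-validStep : ∀ (S : ANS) (s : TrackState S) (ss : ValidState Ss) u →
  foldl validStep (_∷ₐ_ {x = S} s ss) u ≡ _∷ₐ_ {x = S} (foldl (trackStep S) s (map head u)) (foldl validStep ss (map tail u))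
foldl-validStep S s ss []                = refl
foldl-validStep S s ss ((x ∷ₐ xs) ∷ u) = foldl-validStep S (trackStep S s x) (validStep ss xs) u

valid-padEach : ∀ (u : List (All Sym Ss)) (ws : All Word Ss) → AllInL ws → LengthsAtMost (length u) ws →
                tracks u ≡ padEach (length u) ws → T (validAccept (foldl validStep validStart u))
valid-padEach {Ss = []ᵥ} u ws _ _ _ with foldl validStep []ₐ u
... | []ₐ = tt
valid-padEach {Ss = S ∷ᵥ Ss} u (w ∷ₐ ws) (w∈L , ws∈L) (|w|≤ , fits) tracks≡
  rewrite foldl-validStep S (leading S) validStart u = from T-∧
    ( subst T (sym (trans (cong (trackAccept S ∘ foldl (trackStep S) (leading S)) (cong head tracks≡))
                          (TrackAutomaton.trackAccept-pad S (length u ∸ length w) w))) w∈L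
    , valid-padEach (map tail u) ws ws∈L (subst (λ n → LengthsAtMost n ws) (sym (length-map tail u)) fits)
        (trans (cong tail tracks≡) (cong (λ n → padEach n ws) (sym (length-map tail u)))))

accepted⇒padEach : ∀ (u : List (All Sym Ss)) → T (validAccept (foldl validStep validStart u)) →
  Σ (All Word Ss) λ ws → AllInL ws × LengthsAtMost (length u) ws × tracks u ≡ padEach (length u) ws
accepted⇒padEach {Ss = []ᵥ} u _ = []ₐ , tt , tt , refl
accepted⇒padEach {Ss = S ∷ᵥ Ss} u acc rewrite foldl-validStep S (leading S) validStart u
  with to T-∧ acc
... | head-acc , tail-acc with TrackAutomaton.accepted-leading S (map head u) head-acc | accepted⇒padEach (map tail u) tail-acc
... | a , w , heads≡ | ws , ws∈L , fits , tails≡ =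
  w ∷ₐ ws , (w∈L , ws∈L) , (|w|≤ , subst (λ n → LengthsAtMost n ws) (length-map tail u) fits) ,
  cong₂ _∷ₐ_ heads≡pad (trans tails≡ (cong (λ n → padEach n ws) (length-map tail u)))
  where
  w∈L : T (inL S w)
  w∈L = subst T (TrackAutomaton.trackAccept-pad S a w)
          (subst (T ∘ trackAccept S ∘ foldl (trackStep S) (leading S)) heads≡ head-acc)
  |u|≡ : length u ≡ a + length w
  |u|≡ = trans (sym (length-map head u)) (trans (cong length heads≡)
           (trans (length-++ (replicate a nothing)) (cong₂ _+_ (length-replicate a) (length-map just w))))
  |w|≤ : length w ≤ length u
  |w|≤ = subst (length w ≤_) (sym |u|≡) (m≤n+m (length w) a)
  heads≡pad : map head u ≡ pad (length u) w
  heads≡pad = trans heads≡ (cong (λ n → replicate n nothing ++ map just w)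
                (sym (trans (cong (_∸ length w) |u|≡) (m+n∸n≡m a (length w)))))

dropHashes : List (All Sym Ss) → List (Letter Ss)
dropHashes []      = []
dropHashes (a ∷ u) with AllHash? a
... | yes _     = dropHashes u
... | no ¬hash = (a , ¬hash) ∷ dropHashes u

skipHashes : (M : DFA (Letter Ss)) → Fin (DFA.nQ M) → All Sym Ss → Fin (DFA.nQ M)
skipHashes M q a with AllHash? a
... | yes _     = q
... | no ¬hash = DFA.δ M q (a , ¬hash)

foldl-skipHashes : ∀ (M : DFA (Letter Ss)) q u → foldl (skipHashes M) q u ≡ runFrom M q (dropHashes u)
foldl-skipHashes M q []      = refl
foldl-skipHashes M q (a ∷ u) with AllHash? a
... | yes _     = foldl-skipHashes M q u
... | no ¬hash = foldl-skipHashes M (DFA.δ M q (a , ¬hash)) u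

dropHashes-hashes-++ : ∀ n (u : List (All Sym Ss)) → dropHashes (replicate n hashes ++ u) ≡ dropHashes u
dropHashes-hashes-++ zero    u = refl
dropHashes-hashes-++ {Ss = Ss} (suc n) u with AllHash? (hashes {Ss = Ss})
... | yes _        = dropHashes-hashes-++ n u
... | no ¬hashes = ⊥-elim (¬hashes AllHash-hashes)

map-proj₁-dropHashes : ∀ (w : List (Letter Ss)) → map proj₁ (dropHashes (map proj₁ w)) ≡ map proj₁ w
map-proj₁-dropHashes []              = refl
map-proj₁-dropHashes ((a , ¬hash) ∷ w) with AllHash? a
... | yes hash = ⊥-elim (¬hash hash)
... | no _     = cong (a ∷_) (map-proj₁-dropHashes w)

RepV-dropHashes : ∀ {ns} (ws : All Word Ss) a → RepAll Ss ns ws → RepV Ss ns (dropHashes (replicate a hashes ++ parallel ws))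
RepV-dropHashes ws a rs = ws , rs , (begin
    map proj₁ (dropHashes (replicate a hashes ++ parallel ws)) ≡⟨ cong (map proj₁) (dropHashes-hashes-++ a (parallel ws)) ⟩
    map proj₁ (dropHashes (parallel ws))                       ≡⟨ cong (map proj₁ ∘ dropHashes) (sym (proj₂ (letters ws))) ⟩
    map proj₁ (dropHashes (map proj₁ (proj₁ (letters ws))))    ≡⟨ map-proj₁-dropHashes (proj₁ (letters ws)) ⟩
    map proj₁ (proj₁ (letters ws))                            ≡⟨ proj₂ (letters ws) ⟩
    parallel ws                                              ∎)
  where open ≡-Reasoning

-- An automaton recognizing the words ♯ⁿ t, for a word t not starting with ♯.
module HashesThen {X : Set} (_≟_ : DecidableEquality X) (♯ : X) where

  -- A suffix of b ∷ t is either b ∷ t itself (nothing) or a suffix of t.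
  Suffix : List X → Set
  Suffix []      = ⊤
  Suffix (b ∷ t) = Maybe (Suffix t)

  finite-Suffix : ∀ t → Finite (Suffix t)
  finite-Suffix []      = finite-⊤
  finite-Suffix (b ∷ t) = finite-Maybe (finite-Suffix t)

  whole : ∀ t → Suffix t
  whole []      = tt
  whole (b ∷ t) = nothing

  remaining : ∀ t → Suffix t → List X
  remaining []      _        = []
  remaining (b ∷ t) nothing  = b ∷ t
  remaining (b ∷ t) (just s) = remaining t s

  remaining-whole : ∀ t → remaining t (whole t) ≡ t
  remaining-whole []      = refl
  remaining-whole (b ∷ t) = refl

  consume : ∀ t → Suffix t → X → Maybe (Suffix t)
  consume []      _        x = nothing
  consume (b ∷ t) nothing  x = if _==_ _≟_ x b then just (just (whole t)) else nothing
  consume (b ∷ t) (just s) x = Maybe.map just (consume t s x)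

  finished : ∀ t → Suffix t → Bool
  finished []      _        = true
  finished (b ∷ t) nothing  = false
  finished (b ∷ t) (just s) = finished t s

  matchStep : ∀ t → Maybe (Suffix t) → X → Maybe (Suffix t)
  matchStep t nothing  x = nothing
  matchStep t (just s) x = consume t s x

  matchAccept : ∀ t → Maybe (Suffix t) → Bool
  matchAccept t nothing  = false
  matchAccept t (just s) = finished t s

  foldl-matchStep-nothing : ∀ t ys → foldl (matchStep t) nothing ys ≡ nothing
  foldl-matchStep-nothing t []       = refl
  foldl-matchStep-nothing t (y ∷ ys) = foldl-matchStep-nothing t ys

  foldl-matchStep-just : ∀ t b (s : Maybe (Suffix t)) ys →
    foldl (matchStep (b ∷ t)) (Maybe.map just s) ys ≡ Maybe.map just (foldl (matchStep t) s ys)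
  foldl-matchStep-just t b nothing  ys =
    trans (foldl-matchStep-nothing (b ∷ t) ys) (cong (Maybe.map just) (sym (foldl-matchStep-nothing t ys)))
  foldl-matchStep-just t b (just s) []       = refl
  foldl-matchStep-just t b (just s) (y ∷ ys) = foldl-matchStep-just t b (consume t s y) ys

  matchAccept-just : ∀ t b (s : Maybe (Suffix t)) → matchAccept (b ∷ t) (Maybe.map just s) ≡ matchAccept t s
  matchAccept-just t b nothing  = refl
  matchAccept-just t b (just s) = refl

  match-remaining : ∀ t s → T (matchAccept t (foldl (matchStep t) (just s) (remaining t s)))
  match-remaining []      s = tt
  match-remaining (b ∷ t) nothing
    rewrite ==-refl _≟_ b | foldl-matchStep-just t b (just (whole t)) t
          | matchAccept-just t b (foldl (matchStep t) (just (whole t)) t) =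
    subst (T ∘ matchAccept t ∘ foldl (matchStep t) (just (whole t))) (remaining-whole t) (match-remaining t (whole t))
  match-remaining (b ∷ t) (just s)
    rewrite foldl-matchStep-just t b (just s) (remaining t s)
          | matchAccept-just t b (foldl (matchStep t) (just s) (remaining t s)) = match-remaining t s

  matched⇒remaining : ∀ t s ys → T (matchAccept t (foldl (matchStep t) (just s) ys)) → ys ≡ remaining t s
  matched⇒remaining []      s        []       _   = refl
  matched⇒remaining []      s        (y ∷ ys) acc rewrite foldl-matchStep-nothing [] ys = ⊥-elim acc
  matched⇒remaining (b ∷ t) nothing  []       acc = ⊥-elim acc
  matched⇒remaining (b ∷ t) nothing  (y ∷ ys) acc with _==_ _≟_ y b in y==b
  ... | false rewrite foldl-matchStep-nothing (b ∷ t) ys = ⊥-elim acc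
  ... | true rewrite foldl-matchStep-just t b (just (whole t)) ys
                   | matchAccept-just t b (foldl (matchStep t) (just (whole t)) ys) =
    cong₂ _∷_ (==⇒≡ _≟_ (from T-≡ y==b)) (trans (matched⇒remaining t (whole t) ys acc) (remaining-whole t))
  matched⇒remaining (b ∷ t) (just s) ys acc
    rewrite foldl-matchStep-just t b (just s) ys | matchAccept-just t b (foldl (matchStep t) (just s) ys) =
    matched⇒remaining t s ys acc

  -- The flag records that only ♯ has been read so far.
  HashState : List X → Set
  HashState t = Bool × Maybe (Suffix t)

  finite-HashState : ∀ t → Finite (HashState t)
  finite-HashState t = finite-× finite-Bool (finite-Maybe (finite-Suffix t))

  hashStart : ∀ t → HashState t
  hashStart t = true , just (whole t)

  hashStep : ∀ t → HashState t → X → HashState t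
  hashStep t (true  , s) x = if _==_ _≟_ x ♯ then (true , s) else (false , matchStep t s x)
  hashStep t (false , s) x = false , matchStep t s x

  hashAccept : ∀ t → HashState t → Bool
  hashAccept t (_ , s) = matchAccept t s

  foldl-hashStep-false : ∀ t s ys → foldl (hashStep t) (false , s) ys ≡ (false , foldl (matchStep t) s ys)
  foldl-hashStep-false t s []       = refl
  foldl-hashStep-false t s (y ∷ ys) = foldl-hashStep-false t (matchStep t s y) ys

  hashAccepted⇒ : ∀ t s ys → T (hashAccept t (foldl (hashStep t) (true , s) ys)) →
    Σ ℕ λ n → Σ (List X) λ zs → ys ≡ replicate n ♯ ++ zs × T (matchAccept t (foldl (matchStep t) s zs))
  hashAccepted⇒ t s []       acc = 0 , [] , refl , acc
  hashAccepted⇒ t s (y ∷ ys) acc with _==_ _≟_ y ♯ in y==♯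
  ... | true with hashAccepted⇒ t s ys acc
  ...   | n , zs , ys≡ , zs-acc = suc n , zs , cong₂ _∷_ (==⇒≡ _≟_ (from T-≡ y==♯)) ys≡ , zs-acc
  hashAccepted⇒ t s (y ∷ ys) acc | false =
    0 , y ∷ ys , refl , subst (T ∘ hashAccept t) (foldl-hashStep-false t (matchStep t s y) ys) acc

  ⇒hashAccepted : ∀ t s n zs → T (matchAccept t (foldl (matchStep t) s zs)) →
                  (∀ {z zs′} → zs ≡ z ∷ zs′ → z ≢ ♯) →
                  T (hashAccept t (foldl (hashStep t) (true , s) (replicate n ♯ ++ zs)))
  ⇒hashAccepted t s (suc n) zs acc z≢♯ rewrite ==-refl _≟_ ♯ = ⇒hashAccepted t s n zs acc z≢♯
  ⇒hashAccepted t s zero    []       acc z≢♯ = acc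
  ⇒hashAccepted t s zero    (z ∷ zs) acc z≢♯
    rewrite ≢⇒==false _≟_ (z≢♯ refl) | foldl-hashStep-false t (matchStep t s z) zs = acc

Padded : (Ss : Vec ANS e) → Vec ℕ e → List (All Sym Ss) → Set
Padded Ss ns u = Σ (All Word Ss) λ ws → RepAll Ss ns ws × Σ ℕ λ a → u ≡ replicate a hashes ++ parallel ws

length-Padded : ∀ {ns} {u : List (All Sym Ss)} ((ws , _ , a , _) : Padded Ss ns u) → length u ≡ a + maxLen ws
length-Padded {u = u} (ws , _ , a , u≡) = trans (cong length u≡) (length-hashes-++-parallel a ws)

tracks-Padded : ∀ {ns} {u : List (All Sym Ss)} ((ws , _ , _ , _) : Padded Ss ns u) → tracks u ≡ padEach (length u) ws
tracks-Padded {u = u} p@(ws , _ , a , u≡) =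
  trans (cong tracks u≡) (trans (tracks-hashes-++-parallel a ws) (cong (λ n → padEach n ws) (sym (length-Padded p))))

tracks⇒Padded : ∀ {ns} (u : List (All Sym Ss)) ws → RepAll Ss ns ws → maxLen ws ≤ length u →
                tracks u ≡ padEach (length u) ws → Padded Ss ns u
tracks⇒Padded u ws rs maxLen≤ tracks≡ = ws , rs , _ ,
  ≡hashes-++-parallel u ws (LengthsAtMost-mono ws maxLen≤ (LengthsAtMost-maxLen ws)) tracks≡

ranks : ∀ {e} {Ss : Vec ANS e} → All Word Ss → Vec ℕ e
ranks []ₐ                       = []ᵥ
ranks {Ss = S ∷ᵥ Ss} (w ∷ₐ ws) = rank S w ∷ᵥ ranks ws

RepAll-ranks : ∀ (ws : All Word Ss) → AllInL ws → RepAll Ss (ranks ws) ws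
RepAll-ranks []ₐ       _              = tt
RepAll-ranks (w ∷ₐ ws) (w∈L , ws∈L) = (w∈L , refl) , RepAll-ranks ws ws∈L

RepAll⇒AllInL : ∀ {ns} (ws : All Word Ss) → RepAll Ss ns ws → AllInL ws
RepAll⇒AllInL {ns = []ᵥ}     []ₐ       _        = tt
RepAll⇒AllInL {ns = n ∷ᵥ ns} (w ∷ₐ ws) (r , rs) = proj₁ r , RepAll⇒AllInL ws rs

valid⇒Padded : ∀ {e} {Ss : Vec ANS e} (u : List (All Sym Ss)) → T (validAccept (foldl validStep validStart u)) →
               Σ (Vec ℕ e) λ ns → Padded Ss ns u
valid⇒Padded u acc with accepted⇒padEach u acc
... | ws , ws∈L , fits , tracks≡ = ranks ws , tracks⇒Padded u ws (RepAll-ranks ws ws∈L) (maxLen-lub _ ws fits) tracks≡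

Padded⇒valid : ∀ {ns} (u : List (All Sym Ss)) → Padded Ss ns u → T (validAccept (foldl validStep validStart u))
Padded⇒valid u p@(ws , rs , a , _) = valid-padEach u ws (RepAll⇒AllInL ws rs)
  (LengthsAtMost-mono ws (≤-trans (m≤n+m (maxLen ws) a) (≤-reflexive (sym (length-Padded p)))) (LengthsAtMost-maxLen ws))
  (tracks-Padded p)

lefts : ∀ (Ss₁ : Vec ANS e₁) → List (Letter (Ss₁ ++ᵥ Ss₂)) → List (All Sym Ss₁)
lefts Ss₁ = map (++ˡ⁻ Ss₁ ∘ proj₁)

rights : ∀ (Ss₁ : Vec ANS e₁) → List (Letter (Ss₁ ++ᵥ Ss₂)) → List (All Sym Ss₂)
rights Ss₁ = map (++ʳ⁻ Ss₁ ∘ proj₁)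

tracks-lefts-rights : ∀ (Ss₁ : Vec ANS e₁) (c : List (Letter (Ss₁ ++ᵥ Ss₂))) →
                      tracks (map proj₁ c) ≡ ++⁺ (tracks (lefts Ss₁ c)) (tracks (rights Ss₁ c))
tracks-lefts-rights Ss₁ c = trans (tracks-split Ss₁ (map proj₁ c))
  (cong₂ ++⁺ (cong tracks (sym (map-∘ {g = ++ˡ⁻ Ss₁} {f = proj₁} c)))
             (cong tracks (sym (map-∘ {g = ++ʳ⁻ Ss₁} {f = proj₁} c))))

-- Because no letter is (#,…,#).
hashPrefixes-exclusive : ∀ (Ss₁ : Vec ANS e₁) (c : List (Letter (Ss₁ ++ᵥ Ss₂))) a b {X Y} →
  lefts Ss₁ c ≡ replicate a hashes ++ X → rights Ss₁ c ≡ replicate b hashes ++ Y → a ≡ 0 ⊎ b ≡ 0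
hashPrefixes-exclusive Ss₁ c                   zero    b       _     _      = inj₁ refl
hashPrefixes-exclusive Ss₁ c                   (suc a) zero    _     _      = inj₂ refl
hashPrefixes-exclusive Ss₁ ((ℓ , ¬hash) ∷ c) (suc a) (suc b) left≡ right≡ =
  ⊥-elim (¬hash (subst AllHash (++⁺-++⁻ Ss₁ ℓ)
    (AllHash-++⁺ _ _ (subst AllHash (sym (∷-injectiveˡ left≡)) AllHash-hashes)
                     (subst AllHash (sym (∷-injectiveˡ right≡)) AllHash-hashes))))

+≡+⇒≡⊔ : ∀ {L m n a b} → L ≡ a + m → L ≡ b + n → a ≡ 0 ⊎ b ≡ 0 → L ≡ m ⊔ n
+≡+⇒≡⊔ {m = m} {n} {b = b} L≡m   L≡b+n (inj₁ refl) =
  trans L≡m (sym (m≥n⇒m⊔n≡m (subst (n ≤_) (trans (sym L≡b+n) L≡m) (m≤n+m n b))))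
+≡+⇒≡⊔ {m = m} {n} {a = a} L≡a+m L≡n   (inj₂ refl) =
  trans L≡n (sym (m≤n⇒m⊔n≡n (subst (m ≤_) (trans (sym L≡a+m) L≡n) (m≤n+m m a))))

Padded⇒RepV-++ : ∀ (Ss₁ : Vec ANS e₁) (c : List (Letter (Ss₁ ++ᵥ Ss₂))) {ns ns′} →
                 Padded Ss₁ ns (lefts Ss₁ c) → Padded Ss₂ ns′ (rights Ss₁ c) → RepV (Ss₁ ++ᵥ Ss₂) (ns ++ᵥ ns′) c
Padded⇒RepV-++ {Ss₂ = Ss₂} Ss₁ c left@(ws , rs , a , left≡) right@(ws′ , rs′ , b , right≡) =
  ++⁺ ws ws′ , RepAll-++⁺ ws ws′ rs rs′ , ≡parallel (map proj₁ c) (++⁺ ws ws′) |c|≡maxLen tracks≡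
  where
  |c|≡ : ∀ {B : Set} (f : Letter (Ss₁ ++ᵥ Ss₂) → B) → length (map proj₁ c) ≡ length (map f c)
  |c|≡ f = trans (length-map proj₁ c) (sym (length-map f c))
  |c|≡maxLen : length (map proj₁ c) ≡ maxLen (++⁺ ws ws′)
  |c|≡maxLen = trans (+≡+⇒≡⊔ (trans (|c|≡ _) (length-Padded left)) (trans (|c|≡ _) (length-Padded right))
                             (hashPrefixes-exclusive Ss₁ c a b left≡ right≡))
                     (sym (maxLen-++⁺ ws ws′))
  tracks≡ : tracks (map proj₁ c) ≡ padEach (length (map proj₁ c)) (++⁺ ws ws′)
  tracks≡ = trans (tracks-lefts-rights Ss₁ c)
    (trans (cong₂ ++⁺ (trans (tracks-Padded left) (cong (λ n → padEach n ws) (sym (|c|≡ _))))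
                      (trans (tracks-Padded right) (cong (λ n → padEach n ws′) (sym (|c|≡ _)))))
           (sym (padEach-++⁺ _ ws ws′)))

RepV-++⇒Padded : ∀ (Ss₁ : Vec ANS e₁) (c : List (Letter (Ss₁ ++ᵥ Ss₂))) {ns ns′} →
                 RepV (Ss₁ ++ᵥ Ss₂) (ns ++ᵥ ns′) c → Padded Ss₁ ns (lefts Ss₁ c) × Padded Ss₂ ns′ (rights Ss₁ c)
RepV-++⇒Padded {Ss₂ = Ss₂} Ss₁ c {ns} {ns′} (W , rW , c≡) =
  tracks⇒Padded (lefts Ss₁ c) ws (proj₁ rs×rs′) (maxLen≤ (m≤m⊔n (maxLen ws) (maxLen ws′)) (length-map _ c)) left≡ ,
  tracks⇒Padded (rights Ss₁ c) ws′ (proj₂ rs×rs′) (maxLen≤ (m≤n⊔m (maxLen ws) (maxLen ws′)) (length-map _ c)) right≡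
  where
  open ≡-Reasoning
  ws : All Word Ss₁
  ws = ++ˡ⁻ Ss₁ W
  ws′ : All Word Ss₂
  ws′ = ++ʳ⁻ Ss₁ W
  W≡ : ++⁺ ws ws′ ≡ W
  W≡ = ++⁺-++⁻ Ss₁ W
  rs×rs′ : RepAll Ss₁ ns ws × RepAll Ss₂ ns′ ws′
  rs×rs′ = RepAll-++⁻ ws ws′ (subst (RepAll (Ss₁ ++ᵥ Ss₂) (ns ++ᵥ ns′)) (sym W≡) rW)
  L : ℕ
  L = length c
  L≡maxLen : L ≡ maxLen W
  L≡maxLen = trans (sym (length-map proj₁ c)) (trans (cong length c≡) (length-parallel W))
  maxLen≤ : ∀ {m n} → m ≤ maxLen ws ⊔ maxLen ws′ → n ≡ L → m ≤ n
  maxLen≤ m≤ n≡L = ≤-trans m≤ (≤-reflexive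
    (trans (sym (maxLen-++⁺ ws ws′)) (trans (cong maxLen W≡) (trans (sym L≡maxLen) (sym n≡L)))))
  both : ++⁺ (tracks (lefts Ss₁ c)) (tracks (rights Ss₁ c)) ≡ ++⁺ (padEach L ws) (padEach L ws′)
  both = begin
      ++⁺ (tracks (lefts Ss₁ c)) (tracks (rights Ss₁ c)) ≡⟨ sym (tracks-lefts-rights Ss₁ c) ⟩
      tracks (map proj₁ c)                             ≡⟨ cong tracks c≡ ⟩
      tracks (parallel W)                              ≡⟨ tracks-parallel W ⟩
      padEach (maxLen W) W                             ≡⟨ cong₂ padEach (sym L≡maxLen) (sym W≡) ⟩
      padEach L (++⁺ ws ws′)                           ≡⟨ padEach-++⁺ L ws ws′ ⟩
      ++⁺ (padEach L ws) (padEach L ws′)               ∎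
  left≡ : tracks (lefts Ss₁ c) ≡ padEach (length (lefts Ss₁ c)) ws
  left≡ = begin
      tracks (lefts Ss₁ c)                                               ≡⟨ sym (++ˡ⁻-++⁺ _ _) ⟩
      ++ˡ⁻ Ss₁ (++⁺ (tracks (lefts Ss₁ c)) (tracks (rights Ss₁ c)))      ≡⟨ cong (++ˡ⁻ Ss₁) both ⟩
      ++ˡ⁻ Ss₁ (++⁺ (padEach L ws) (padEach L ws′))                      ≡⟨ ++ˡ⁻-++⁺ _ _ ⟩
      padEach L ws                                                       ≡⟨ cong (λ n → padEach n ws) (sym (length-map _ c)) ⟩
      padEach (length (lefts Ss₁ c)) ws                                  ∎
  right≡ : tracks (rights Ss₁ c) ≡ padEach (length (rights Ss₁ c)) ws′
  right≡ = begin
      tracks (rights Ss₁ c)                                              ≡⟨ sym (++ʳ⁻-++⁺ (tracks (lefts Ss₁ c)) _) ⟩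
      ++ʳ⁻ Ss₁ (++⁺ (tracks (lefts Ss₁ c)) (tracks (rights Ss₁ c)))      ≡⟨ cong (++ʳ⁻ Ss₁) both ⟩
      ++ʳ⁻ Ss₁ (++⁺ (padEach L ws) (padEach L ws′))                      ≡⟨ ++ʳ⁻-++⁺ (padEach L ws) _ ⟩
      padEach L ws′                                                      ≡⟨ cong (λ n → padEach n ws′) (sym (length-map _ c)) ⟩
      padEach (length (rights Ss₁ c)) ws′                                ∎

_≟ᶜ_ : DecidableEquality (All Sym Ss)
[]ₐ       ≟ᶜ []ₐ       = yes refl
(x ∷ₐ a) ≟ᶜ (y ∷ₐ b) with Maybe.≡-dec _≟ᶠ_ x y | a ≟ᶜ b
... | yes refl | yes refl = yes refl
... | no x≢y   | _        = no (x≢y ∘ cong head)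
... | _        | no a≢b   = no (a≢b ∘ cong tail)

lookup-universal : ∀ {X : Set} {P : X → Set} (u : ∀ x → P x) {xs x} (x∈ : x ∈ xs) →
                   Allᴸ.lookup (Allᴸ.universal u xs) x∈ ≡ u x
lookup-universal u (here refl) = refl
lookup-universal u (there x∈)  = lookup-universal u x∈

lookup-foldl-map : ∀ {X A : Set} {P : X → Set} (δ : ∀ x → P x → A → P x) {xs x} (ps : Allᴸ P xs) (x∈ : x ∈ xs) u →
  Allᴸ.lookup (foldl (λ ps a → Allᴸ.map (λ {y} p → δ y p a) ps) ps u) x∈ ≡ foldl (δ x) (Allᴸ.lookup ps x∈) u
lookup-foldl-map δ ps x∈ []      = refl
lookup-foldl-map δ ps x∈ (a ∷ u) =
  trans (lookup-foldl-map δ _ x∈ u) (cong (λ p → foldl (δ _) p u) (lookup-map ps x∈))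

-- Run M₀ on the left part (ignoring #-columns) and check its validity; in parallel, for each state q of M₀,
-- test whether the right part is #ⁿ followed by the parallel reading of rep(τ₀ q).
module GraphAutomaton {d d′} (Ss : Vec ANS d) (Ss′ : Vec ANS d′) (M₀ : DFA (Letter Ss))
                      (τ₀ : Fin (DFA.nQ M₀) → Vec ℕ d′) where

  open HashesThen (_≟ᶜ_ {Ss = Ss′}) hashes public

  Q₀ : Set
  Q₀ = Fin (DFA.nQ M₀)

  code : Q₀ → List (All Sym Ss′)
  code q = map proj₁ (proj₁ (repV Ss′ (τ₀ q)))

  Matchers : Set
  Matchers = Allᴸ (HashState ∘ code) (allFin (DFA.nQ M₀))

  stepMatchers : Matchers → All Sym Ss′ → Matchers
  stepMatchers ms x = Allᴸ.map (λ {q} h → hashStep (code q) h x) ms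

  State : Set
  State = ValidState Ss × Q₀ × Matchers

  finite-State : Finite State
  finite-State = finite-× (finite-All finite-TrackState Ss)
    (finite-× (finite-Fin (DFA.nQ M₀)) (finite-Allᴸ (finite-HashState ∘ code) (allFin (DFA.nQ M₀))))

  start : State
  start = validStart , DFA.q₀ M₀ , Allᴸ.universal (hashStart ∘ code) (allFin (DFA.nQ M₀))

  step : State → Letter (Ss ++ᵥ Ss′) → State
  step (v , q , ms) (ℓ , _) = validStep v (++ˡ⁻ Ss ℓ) , skipHashes M₀ q (++ˡ⁻ Ss ℓ) , stepMatchers ms (++ʳ⁻ Ss ℓ)

  accept : State → Bool
  accept (v , q , ms) = validAccept v ∧ hashAccept (code q) (Allᴸ.lookup ms (∈-allFin q))

  graphDFA : DFA (Letter (Ss ++ᵥ Ss′))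
  graphDFA = toDFA finite-State start step

  graphFinal : Fin (DFA.nQ graphDFA) → Bool
  graphFinal = accept ∘ decode finite-State

  foldl-step : ∀ v q ms c → foldl step (v , q , ms) c ≡
    (foldl validStep v (lefts Ss c) , foldl (skipHashes M₀) q (lefts Ss c) , foldl stepMatchers ms (rights Ss c))
  foldl-step v q ms []      = refl
  foldl-step v q ms (ℓ ∷ c) = foldl-step _ _ _ c

  simulated : List (Letter (Ss ++ᵥ Ss′)) → Q₀
  simulated c = run M₀ (dropHashes (lefts Ss c))

  matches : Q₀ → List (All Sym Ss′) → Bool
  matches q u = hashAccept (code q) (foldl (hashStep (code q)) (hashStart (code q)) u)

  accepts-graphDFA : ∀ c → accepts graphDFA graphFinal c ≡
    validAccept (foldl validStep validStart (lefts Ss c)) ∧ matches (simulated c) (rights Ss c)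
  accepts-graphDFA c = begin
      accept (decode finite-State (run graphDFA c))
    ≡⟨ cong accept (trans (decode-run-toDFA finite-State start step c) (foldl-step validStart (DFA.q₀ M₀) _ c)) ⟩
      accept (valid , foldl (skipHashes M₀) (DFA.q₀ M₀) (lefts Ss c) , matchers)
    ≡⟨ cong (λ q → accept (valid , q , matchers)) (foldl-skipHashes M₀ (DFA.q₀ M₀) (lefts Ss c)) ⟩
      validAccept valid ∧ hashAccept (code (simulated c)) (Allᴸ.lookup matchers (∈-allFin (simulated c)))
    ≡⟨ cong (λ h → validAccept valid ∧ hashAccept (code (simulated c)) h)
         (trans (lookup-foldl-map (λ q → hashStep (code q)) _ (∈-allFin (simulated c)) (rights Ss c))
                (cong (λ h → foldl (hashStep (code (simulated c))) h (rights Ss c))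
                      (lookup-universal (hashStart ∘ code) (∈-allFin (simulated c))))) ⟩
      validAccept valid ∧ matches (simulated c) (rights Ss c)
    ∎
    where
    open ≡-Reasoning
    valid : ValidState Ss
    valid = foldl validStep validStart (lefts Ss c)
    matchers : Matchers
    matchers = foldl stepMatchers (proj₂ (proj₂ start)) (rights Ss c)

  code≡parallel : ∀ q → code q ≡ parallel (proj₁ (proj₂ (repV Ss′ (τ₀ q))))
  code≡parallel q = proj₂ (proj₂ (proj₂ (repV Ss′ (τ₀ q))))

  code-head≢hashes : ∀ q {z zs} → code q ≡ z ∷ zs → z ≢ hashes
  code-head≢hashes q = go (proj₁ (repV Ss′ (τ₀ q)))
    where
    go : ∀ (w : List (Letter Ss′)) {z zs} → map proj₁ w ≡ z ∷ zs → z ≢ hashes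
    go ((a , ¬hash) ∷ w) refl refl = ¬hash AllHash-hashes

  matches-hashes-++-code : ∀ q n → T (matches q (replicate n hashes ++ code q))
  matches-hashes-++-code q n = ⇒hashAccepted (code q) (just (whole (code q))) n (code q) whole-matched (code-head≢hashes q)
    where
    whole-matched : T (matchAccept (code q) (foldl (matchStep (code q)) (just (whole (code q))) (code q)))
    whole-matched = subst (T ∘ matchAccept (code q) ∘ foldl (matchStep (code q)) (just (whole (code q))))
                          (remaining-whole (code q)) (match-remaining (code q) (whole (code q)))

  matches⇒hashes-++-code : ∀ q u → T (matches q u) → Σ ℕ λ n → u ≡ replicate n hashes ++ code q
  matches⇒hashes-++-code q u acc with hashAccepted⇒ (code q) (just (whole (code q))) u acc
  ... | n , zs , u≡ , zs-matched = n , trans u≡ (cong (replicate n hashes ++_)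
    (trans (matched⇒remaining (code q) (whole (code q)) zs zs-matched) (remaining-whole (code q))))

  matches⇔Padded : ∀ q u → T (matches q u) ⇔ Padded Ss′ (τ₀ q) u
  matches⇔Padded q u = mk⇔ ⇒ ⇐
    where
    rep-q : RepV Ss′ (τ₀ q) (proj₁ (repV Ss′ (τ₀ q)))
    rep-q = proj₂ (repV Ss′ (τ₀ q))
    ⇒ : T (matches q u) → Padded Ss′ (τ₀ q) u
    ⇒ acc with matches⇒hashes-++-code q u acc
    ... | n , u≡ = proj₁ rep-q , proj₁ (proj₂ rep-q) , n , trans u≡ (cong (replicate n hashes ++_) (code≡parallel q))
    ⇐ : Padded Ss′ (τ₀ q) u → T (matches q u)
    ⇐ (ws , rs , n , u≡) with RepAll-unique Ss′ rs (proj₁ (proj₂ rep-q))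
    ... | refl = subst (T ∘ matches q) (sym (trans u≡ (cong (replicate n hashes ++_) (sym (code≡parallel q)))))
                       (matches-hashes-++-code q n)

automatic⇒synchronized : ∀ {d d′} (Ss : Vec ANS d) (Ss′ : Vec ANS d′) (f : Vec ℕ d → Vec ℕ d′) →
                         Automatic Ss f → Synchronized Ss Ss′ f
automatic⇒synchronized Ss Ss′ f (M₀ , τ₀ , f≡τ₀∘run) = graphDFA , graphFinal , correct
  where
  open GraphAutomaton Ss Ss′ M₀ τ₀
  value : ∀ {ns} c → Padded Ss ns (lefts Ss c) → f ns ≡ τ₀ (simulated c)
  value {ns} c (ws , rs , a , left≡) = f≡τ₀∘run ns (dropHashes (lefts Ss c))
    (subst (RepV Ss ns ∘ dropHashes) (sym left≡) (RepV-dropHashes ws a rs))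
  correct : ∀ c → GraphWord Ss Ss′ f c ⇔ T (accepts graphDFA graphFinal c)
  correct c = mk⇔ ⇒ ⇐
    where
    ⇒ : GraphWord Ss Ss′ f c → T (accepts graphDFA graphFinal c)
    ⇒ (_ , (ns , refl) , x-rep) = subst T (sym (accepts-graphDFA c)) (from T-∧ (valid , matched))
      where
      padded : Padded Ss ns (lefts Ss c) × Padded Ss′ (f ns) (rights Ss c)
      padded = RepV-++⇒Padded Ss c x-rep
      valid : T (validAccept (foldl validStep validStart (lefts Ss c)))
      valid = Padded⇒valid (lefts Ss c) (proj₁ padded)
      matched : T (matches (simulated c) (rights Ss c))
      matched = from (matches⇔Padded (simulated c) (rights Ss c))
        (subst (λ v → Padded Ss′ v (rights Ss c)) (value c (proj₁ padded)) (proj₂ padded))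
    ⇐ : T (accepts graphDFA graphFinal c) → GraphWord Ss Ss′ f c
    ⇐ acc with to T-∧ (subst T (accepts-graphDFA c) acc)
    ... | valid , matched with valid⇒Padded _ valid
    ... | ns , left = ns ++ᵥ τ₀ (simulated c) , (ns , cong (ns ++ᵥ_) (sym (value c left))) ,
                      Padded⇒RepV-++ Ss c left (to (matches⇔Padded _ _) matched)

automatic⇒finiteRange : ∀ {d d′} (Ss : Vec ANS d) (f : Vec ℕ d → Vec ℕ d′) → Automatic Ss f → FiniteRange f
automatic⇒finiteRange Ss f (M , τ , f≡τ∘run) = map τ (allFin (DFA.nQ M)) , λ ns →
  subst (_∈ map τ (allFin (DFA.nQ M))) (sym (f≡τ∘run ns (proj₁ (repV Ss ns)) (proj₂ (repV Ss ns))))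
        (∈-map⁺ τ (∈-allFin (run M (proj₁ (repV Ss ns)))))

proposition8p4 : (d d' : ℕ) → 1 ≤ d → 1 ≤ d' →
    (Ss : Vec ANS d) (Ss' : Vec ANS d') (f : Vec ℕ d → Vec ℕ d') →
    Automatic Ss f ⇔ (Synchronized Ss Ss' f × FiniteRange f)
proposition8p4 d d' _ _ Ss Ss' f = mk⇔
  (λ automatic → automatic⇒synchronized Ss Ss' f automatic , automatic⇒finiteRange Ss f automatic)
  (λ (synchronized , finite) → synchronized⇒automatic Ss Ss' f synchronized finite)
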